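{- Let $n,k\geq 0$ be integers and $p$ a prime. Then $A_{n+m+k,k}\equiv 0\pmod p$ for all $m=0,1,\dots,p-2$ if and only if $A_{n+m+k,k}\equiv A_{n+pm+k,k}\pmod p$ for all $m=1,2,\dots,p-1$.
   Context: A partition of a finite set is a collection of nonempty, pairwise disjoint subsets (blocks) whose union is the set; a singleton of a partition is a block with exactly one element. For integers $0\leq k\leq n$, $A_{n,k}$ denotes the number of partitions of $\{1,2,\dots,n+1\}$ whose largest singleton is $k+1$ (i.e. $\{k+1\}$ is a block and no $j>k+1$ forms a singleton block). -}

module Defs where

open import Data.Bool using (Bool; true; false)
open import Data.Bool.Properties using () renaming (_≟_ to _≟ᵇ_)
open import Data.Nat using (ℕ; zero; suc; _+_; _<_; _<?_; _≡ᵇ_)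
open import Data.Fin using (Fin; toℕ)
open import Data.Fin.Properties using () renaming (all? to allFin?; any? to anyFin?)
open import Data.Vec using (Vec; []; _∷_; lookup; tabulate)
open import Data.Vec.Properties using (≡-dec)
open import Data.List using (List; []; _∷_; [_]; map; _++_; filter; length)
open import Data.List.Relation.Unary.All using (All; all?)
open import Data.List.Relation.Unary.Any using (Any; any?)
open import Data.List.Relation.Unary.AllPairs using (AllPairs; allPairs?)
open import Data.Product using (_×_; Σ; ∃)
open import Relation.Nullary using (¬_; Dec; ¬?)
open import Relation.Nullary.Decidable using (_×-dec_; _→-dec_)
open import Relation.Binary.PropositionalEquality using (_≡_)

-- A subset of the ground set {1,…,N} is represented as a characteristic
-- vector : Vec Bool N  (position i : Fin N stands for the element (toℕ i + 1)).
Subset : ℕ → Set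
Subset N = Vec Bool N

allSubsets : (N : ℕ) → List (Subset N)
allSubsets zero    = [ [] ]
allSubsets (suc N) = map (true ∷_) (allSubsets N) ++ map (false ∷_) (allSubsets N)

-- Applied to the duplicate-free list
-- allSubsets N this enumerates every set of subsets of {1,…,N} exactly once.
sublists : ∀ {a} {A : Set a} → List A → List (List A)
sublists []       = [ [] ]
sublists (x ∷ xs) = map (x ∷_) (sublists xs) ++ sublists xs

Nonempty : ∀ {N} → Subset N → Set
Nonempty {N} b = ∃ λ (i : Fin N) → lookup b i ≡ true

Disjoint : ∀ {N} → Subset N → Subset N → Set
Disjoint {N} b c = (i : Fin N) → ¬ (lookup b i ≡ true × lookup c i ≡ true)

IsPartition : (N : ℕ) → List (Subset N) → Set
IsPartition N bs =
  All Nonempty bs × AllPairs Disjoint bs × ((i : Fin N) → Any (λ b → lookup b i ≡ true) bs)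

-- the singleton subset {j+1} (the position with toℕ-index j)
singleton : (N j : ℕ) → Subset N
singleton N j = tabulate (λ i → toℕ i ≡ᵇ j)

HasSingleton : (N j : ℕ) → List (Subset N) → Set
HasSingleton N j bs = Any (λ b → b ≡ singleton N j) bs

LargestSingleton : (N j : ℕ) → List (Subset N) → Set
LargestSingleton N j bs =
  HasSingleton N j bs × ((i : Fin N) → j < toℕ i → ¬ HasSingleton N (toℕ i) bs)

nonempty? : ∀ {N} (b : Subset N) → Dec (Nonempty b)
nonempty? b = anyFin? (λ i → lookup b i ≟ᵇ true)

disjoint? : ∀ {N} (b c : Subset N) → Dec (Disjoint b c)
disjoint? b c = allFin? (λ i → ¬? ((lookup b i ≟ᵇ true) ×-dec (lookup c i ≟ᵇ true)))

isPartition? : (N : ℕ) (bs : List (Subset N)) → Dec (IsPartition N bs)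
isPartition? N bs =
  all? nonempty? bs ×-dec allPairs? disjoint? bs
    ×-dec allFin? (λ i → any? (λ b → lookup b i ≟ᵇ true) bs)

hasSingleton? : (N j : ℕ) (bs : List (Subset N)) → Dec (HasSingleton N j bs)
hasSingleton? N j bs = any? (λ b → ≡-dec _≟ᵇ_ b (singleton N j)) bs

largestSingleton? : (N j : ℕ) (bs : List (Subset N)) → Dec (LargestSingleton N j bs)
largestSingleton? N j bs =
  hasSingleton? N j bs
    ×-dec allFin? (λ i → (j <? toℕ i) →-dec ¬? (hasSingleton? N (toℕ i) bs))

-- A n k = number of partitions of {1,…,n+1} whose largest singleton is k+1.
A : ℕ → ℕ → ℕ
A n k = length (filter (λ bs → isPartition? (suc n) bs ×-dec largestSingleton? (suc n) k bs)
                       (sublists (allSubsets (suc n))))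

-- Removing the block {k+1} identifies A_{n,k} with the number G(k, n) of partitions of an
-- n-set in which no element beyond the first k is a singleton.  Splitting on whether the
-- (k+1)-st element is a singleton gives G(k+1, N+1) = G(k, N+1) + G(k, N), and G(k, k) is the
-- Bell number B_k, so g(k, j) = A_{j+k,k} satisfies B_{k+j} = Σ_i C(j, i) g(k, i).  Touchard's
-- congruence B_{n+p} ≡ B_n + B_{n+1} (mod p), proved from Fermat's little theorem through the
-- Stirling numbers of the second kind, carries over to g(k, j+p) ≡ g(k, j) + g(k, j+1), and
-- iterating gives g(k, j+pm) ≡ Σ_{i≤m} C(m, i) g(k, j+i).  For b(m) = A_{n+m+k,k} the top term of
-- this sum is b(m), so b(m) ≡ b(pm) for 1 ≤ m ≤ p-1 exactly when all lower terms vanish, and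
-- since C(m, m-1) = m is a unit mod p this happens exactly when b(0), …, b(p-2) ≡ 0.

module Submission where

open import Defs
open import Data.Bool using (Bool; true; false; _∧_; _∨_; not)
open import Data.Bool.Properties using (∧-zeroʳ; ∧-identityʳ) renaming (_≟_ to _≟ᵇ_)
open import Data.Nat using (ℕ; zero; suc; _+_; _*_; _∸_; _^_; _≤_; _<_; z≤n; s≤s; _≤?_)
open import Data.Nat.Properties
open import Algebra.Properties.CommutativeSemigroup +-commutativeSemigroup using () renaming (interchange to +-interchange)
open import Data.Nat.Combinatorics using (_C_; nCk+nC[k+1]≡[n+1]C[k+1]; k>n⇒nCk≡0; nCn≡1; nC1≡n; nCk≡nC[n∸k])
open import Data.Nat.Divisibility using (_∣_; ∣⇒≤)
open import Data.Nat.Induction using (<-rec)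
open import Data.Nat.Primality using (Prime; euclidsLemma; ¬prime[0]; ¬prime[1])
open import Data.Nat.Tactic.RingSolver using (solve-∀)
import Data.Integer as ℤ
import Data.Integer.Properties as ℤ
open import Data.Integer.Divisibility using () renaming (_∣_ to _∣ℤ_)
open import Data.Integer.Divisibility.Signed using (divides; ∣m∣n⇒∣m+n; ∣m⇒∣-m; ∣n⇒∣m*n; ∣⇒∣ᵤ; ∣ᵤ⇒∣) renaming (_∣_ to _∣ˢ_)
import Data.Integer.Tactic.RingSolver as ℤ-Solver
open import Data.Fin using (Fin; toℕ; zero; suc; fromℕ<)
open import Data.Fin.Properties using (toℕ-fromℕ<) renaming (all? to allFin?)
open import Data.Vec using (Vec; []; _∷_; lookup; replicate; tabulate; _[_]≔_; insertAt; removeAt)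
open import Data.Vec.Properties using (lookup∘update; insertAt-lookup; lookup-replicate)
open import Data.List using (List; []; _∷_; [_]; map; _++_; filter; length)
open import Data.List.Relation.Unary.All using (All; all?; []; _∷_)
import Data.List.Relation.Unary.All as All
open import Data.List.Relation.Unary.All.Properties using (All¬⇒¬Any; map⁺; map⁻)
open import Data.List.Relation.Unary.Any using (Any; any?; here; there)
open import Data.List.Relation.Unary.AllPairs using (AllPairs; allPairs?; []; _∷_)
import Data.List.Relation.Unary.AllPairs as AllPairs
open import Data.List.Relation.Unary.AllPairs.Properties using () renaming (map⁺ to AllPairs-map⁺; map⁻ to AllPairs-map⁻)
open import Data.Product using (_×_; _,_; proj₁; proj₂)
open import Data.Sum using (inj₁; inj₂; [_,_]′)
open import Data.Unit using (⊤; tt)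
open import Data.Empty using (⊥-elim)
open import Relation.Nullary using (¬_; Dec; yes; no; ¬?; does)
open import Relation.Nullary.Decidable using (_×-dec_; _→-dec_)
open import Relation.Unary using (Decidable)
open import Relation.Binary using (IsEquivalence; Setoid)
open import Relation.Binary.PropositionalEquality hiding ([_])
import Relation.Binary.Reasoning.Setoid as SetoidReasoning
open import Function using (_∘_)
open import Function.Bundles using (_⇔_; mk⇔; Equivalence)
open import Level using (Level)

private
  variable
    ℓ₁ ℓ₂ : Level
    X : Set ℓ₁
    Y : Set ℓ₂

∑< : ℕ → (ℕ → ℕ) → ℕ
∑< zero    f = 0
∑< (suc n) f = ∑< n f + f n

syntax ∑< n (λ i → e) = ∑[ i < n ] e

∑-cong : ∀ n {f g : ℕ → ℕ} → (∀ i → i < n → f i ≡ g i) → ∑< n f ≡ ∑< n g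
∑-cong zero    f≡g = refl
∑-cong (suc n) f≡g = cong₂ _+_ (∑-cong n (λ i i<n → f≡g i (m<n⇒m<1+n i<n))) (f≡g n (n<1+n n))

∑-zero : ∀ n (f : ℕ → ℕ) → (∀ i → i < n → f i ≡ 0) → ∑< n f ≡ 0
∑-zero zero    f f≡0 = refl
∑-zero (suc n) f f≡0 = cong₂ _+_ (∑-zero n f (λ i i<n → f≡0 i (m<n⇒m<1+n i<n))) (f≡0 n (n<1+n n))

∑-head : ∀ n (f : ℕ → ℕ) → ∑< (suc n) f ≡ f 0 + ∑< n (f ∘ suc)
∑-head zero    f = +-comm 0 (f 0)
∑-head (suc n) f = trans (cong (_+ f (suc n)) (∑-head n f)) (+-assoc (f 0) _ _)

∑-distrib-+ : ∀ n (f g : ℕ → ℕ) → ∑[ i < n ] (f i + g i) ≡ ∑< n f + ∑< n g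
∑-distrib-+ zero    f g = refl
∑-distrib-+ (suc n) f g = trans (cong (_+ (f n + g n)) (∑-distrib-+ n f g)) (+-interchange (∑< n f) (∑< n g) (f n) (g n))

∑-distribˡ-* : ∀ n k (f : ℕ → ℕ) → ∑[ i < n ] (k * f i) ≡ k * ∑< n f
∑-distribˡ-* zero    k f = sym (*-zeroʳ k)
∑-distribˡ-* (suc n) k f = trans (cong (_+ k * f n) (∑-distribˡ-* n k f)) (sym (*-distribˡ-+ k (∑< n f) (f n)))

∑-split : ∀ a b (f : ℕ → ℕ) → ∑< (a + b) f ≡ ∑< a f + ∑[ t < b ] f (a + t)
∑-split a zero    f = trans (cong (λ n → ∑< n f) (+-identityʳ a)) (sym (+-identityʳ _))
∑-split a (suc b) f = begin
  ∑< (a + suc b) f                               ≡⟨ cong (λ n → ∑< n f) (+-suc a b) ⟩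
  ∑< (a + b) f + f (a + b)                       ≡⟨ cong (_+ f (a + b)) (∑-split a b f) ⟩
  (∑< a f + ∑[ t < b ] f (a + t)) + f (a + b)    ≡⟨ +-assoc (∑< a f) _ _ ⟩
  ∑< a f + ∑[ t < suc b ] f (a + t)              ∎
  where open ≡-Reasoning

∑-truncate : ∀ {a n} (f : ℕ → ℕ) → a ≤ n → (∀ i → a ≤ i → f i ≡ 0) → ∑< n f ≡ ∑< a f
∑-truncate {a} {n} f a≤n f≡0 = begin
  ∑< n f                              ≡⟨ cong (λ m → ∑< m f) (sym (m+[n∸m]≡n a≤n)) ⟩
  ∑< (a + (n ∸ a)) f                  ≡⟨ ∑-split a (n ∸ a) f ⟩
  ∑< a f + ∑[ t < n ∸ a ] f (a + t)   ≡⟨ cong (∑< a f +_) (∑-zero (n ∸ a) _ (λ t _ → f≡0 (a + t) (m≤m+n a t))) ⟩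
  ∑< a f + 0                          ≡⟨ +-identityʳ _ ⟩
  ∑< a f                              ∎
  where open ≡-Reasoning

∑-comm : ∀ n m (f : ℕ → ℕ → ℕ) → ∑[ i < n ] ∑< m (f i) ≡ ∑[ j < m ] ∑[ i < n ] f i j
∑-comm zero    m f = sym (∑-zero m _ (λ _ _ → refl))
∑-comm (suc n) m f = trans (cong (_+ ∑< m (f n)) (∑-comm n m f)) (sym (∑-distrib-+ m _ _))

∑-pascal : ∀ m (f : ℕ → ℕ) →
  ∑[ i < suc (suc m) ] ((suc m C i) * f i) ≡ ∑[ i < suc m ] ((m C i) * f i) + ∑[ i < suc m ] ((m C i) * f (suc i))
∑-pascal m f = begin
  ∑[ i < suc (suc m) ] ((suc m C i) * f i)
    ≡⟨ ∑-head (suc m) _ ⟩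
  f 0 + 0 + ∑[ i < suc m ] ((suc m C suc i) * f (suc i))
    ≡⟨ cong (f 0 + 0 +_) (trans (∑-cong (suc m) (λ i _ → pascal-term i)) (∑-distrib-+ (suc m) _ _)) ⟩
  f 0 + 0 + (∑[ i < suc m ] ((m C suc i) * f (suc i)) + ∑[ i < suc m ] ((m C i) * f (suc i)))
    ≡⟨ sym (+-assoc (f 0 + 0) _ _) ⟩
  f 0 + 0 + ∑[ i < suc m ] ((m C suc i) * f (suc i)) + ∑[ i < suc m ] ((m C i) * f (suc i))
    ≡⟨ cong (λ s → f 0 + 0 + s + ∑[ i < suc m ] ((m C i) * f (suc i)))
            (∑-truncate _ (n≤1+n m) (λ i m≤i → cong (_* f (suc i)) (k>n⇒nCk≡0 (s≤s m≤i)))) ⟩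
  f 0 + 0 + ∑[ i < m ] ((m C suc i) * f (suc i)) + ∑[ i < suc m ] ((m C i) * f (suc i))
    ≡⟨ cong (_+ ∑[ i < suc m ] ((m C i) * f (suc i))) (sym (∑-head m (λ i → (m C i) * f i))) ⟩
  ∑[ i < suc m ] ((m C i) * f i) + ∑[ i < suc m ] ((m C i) * f (suc i))
    ∎
  where
  open ≡-Reasoning
  pascal-term : ∀ i → (suc m C suc i) * f (suc i) ≡ (m C suc i) * f (suc i) + (m C i) * f (suc i)
  pascal-term i = trans (cong (_* f (suc i)) (trans (sym (nCk+nC[k+1]≡[n+1]C[k+1] m i)) (+-comm (m C i) _)))
                        (*-distribʳ-+ (f (suc i)) (m C suc i) (m C i))

[1+n]C[1+k]-absorption : ∀ n k → suc k * (suc n C suc k) ≡ suc n * (n C k)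
[1+n]C[1+k]-absorption zero    zero    = refl
[1+n]C[1+k]-absorption zero    (suc k) = *-zeroʳ (suc (suc k))
[1+n]C[1+k]-absorption (suc n) zero    = trans (+-identityʳ _) (trans (nC1≡n (suc (suc n))) (sym (*-identityʳ (suc (suc n)))))
[1+n]C[1+k]-absorption (suc n) (suc k) = begin
  suc (suc k) * (suc (suc n) C suc (suc k))
    ≡⟨ cong (suc (suc k) *_) (sym (nCk+nC[k+1]≡[n+1]C[k+1] (suc n) (suc k))) ⟩
  suc (suc k) * (suc n C suc k + suc n C suc (suc k))
    ≡⟨ *-distribˡ-+ (suc (suc k)) (suc n C suc k) _ ⟩
  suc n C suc k + suc k * (suc n C suc k) + suc (suc k) * (suc n C suc (suc k))
    ≡⟨ cong₂ (λ a b → suc n C suc k + a + b) ([1+n]C[1+k]-absorption n k) ([1+n]C[1+k]-absorption n (suc k)) ⟩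
  suc n C suc k + suc n * (n C k) + suc n * (n C suc k)
    ≡⟨ +-assoc (suc n C suc k) _ _ ⟩
  suc n C suc k + (suc n * (n C k) + suc n * (n C suc k))
    ≡⟨ cong (suc n C suc k +_) (sym (*-distribˡ-+ (suc n) (n C k) _)) ⟩
  suc n C suc k + suc n * (n C k + n C suc k)
    ≡⟨ cong (λ c → suc n C suc k + suc n * c) (nCk+nC[k+1]≡[n+1]C[k+1] n k) ⟩
  suc (suc n) * (suc n C suc k)
    ∎
  where open ≡-Reasoning

[1+n]Cn≡1+n : ∀ n → suc n C n ≡ suc n
[1+n]Cn≡1+n n = trans (nCk≡nC[n∸k] (n≤1+n n)) (trans (cong (suc n C_) (m+n∸n≡m 1 n)) (nC1≡n (suc n)))

binomial-theorem : ∀ a n → suc a ^ n ≡ ∑[ i < suc n ] ((n C i) * a ^ i)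
binomial-theorem a zero    = refl
binomial-theorem a (suc n) = begin
  suc a ^ n + a * suc a ^ n
    ≡⟨ cong₂ (λ s t → s + a * t) (binomial-theorem a n) (binomial-theorem a n) ⟩
  ∑[ i < suc n ] ((n C i) * a ^ i) + a * ∑[ i < suc n ] ((n C i) * a ^ i)
    ≡⟨ cong (∑[ i < suc n ] ((n C i) * a ^ i) +_)
            (trans (sym (∑-distribˡ-* (suc n) a _)) (∑-cong (suc n) (λ i _ → x∙yz≈y∙xz a (n C i) (a ^ i)))) ⟩
  ∑[ i < suc n ] ((n C i) * a ^ i) + ∑[ i < suc n ] ((n C i) * a ^ suc i)
    ≡⟨ sym (∑-pascal n (a ^_)) ⟩
  ∑[ i < suc (suc n) ] ((suc n C i) * a ^ i)
    ∎
  where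
  open ≡-Reasoning
  x∙yz≈y∙xz : ∀ x y z → x * (y * z) ≡ y * (x * z)
  x∙yz≈y∙xz = solve-∀

module Modular (p : ℕ) where

  infix 4 _≋_
  record _≋_ (x y : ℕ) : Set where
    constructor mk≋
    field divides-difference : ℤ.+ p ∣ˢ ℤ.+ x ℤ.- ℤ.+ y

  ≡⇒≋ : ∀ {x y} → x ≡ y → x ≋ y
  ≡⇒≋ {x} refl = mk≋ (subst (ℤ.+ p ∣ˢ_) (sym (ℤ.+-inverseʳ (ℤ.+ x))) (divides (ℤ.+ 0) refl))

  ≋-refl : ∀ {x} → x ≋ x
  ≋-refl = ≡⇒≋ refl

  ≋-sym : ∀ {x y} → x ≋ y → y ≋ x
  ≋-sym {x} {y} (mk≋ d) = mk≋ (subst (ℤ.+ p ∣ˢ_) (negate-difference (ℤ.+ x) (ℤ.+ y)) (∣m⇒∣-m d))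
    where negate-difference : ∀ a b → ℤ.- (a ℤ.- b) ≡ b ℤ.- a
          negate-difference = ℤ-Solver.solve-∀

  ≋-trans : ∀ {x y z} → x ≋ y → y ≋ z → x ≋ z
  ≋-trans {x} {y} {z} (mk≋ d) (mk≋ e) = mk≋ (subst (ℤ.+ p ∣ˢ_) (telescope (ℤ.+ x) (ℤ.+ y) (ℤ.+ z)) (∣m∣n⇒∣m+n d e))
    where telescope : ∀ a b c → (a ℤ.- b) ℤ.+ (b ℤ.- c) ≡ a ℤ.- c
          telescope = ℤ-Solver.solve-∀

  ≋-isEquivalence : IsEquivalence _≋_
  ≋-isEquivalence = record { refl = ≋-refl ; sym = ≋-sym ; trans = ≋-trans }

  ≋-setoid : Setoid _ _
  ≋-setoid = record { isEquivalence = ≋-isEquivalence }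

  module ≋-Reasoning = SetoidReasoning ≋-setoid

  +-cong : ∀ {x y z w} → x ≋ y → z ≋ w → x + z ≋ y + w
  +-cong {x} {y} {z} {w} (mk≋ d) (mk≋ e) =
    mk≋ (subst (ℤ.+ p ∣ˢ_) (trans (regroup (ℤ.+ x) (ℤ.+ y) (ℤ.+ z) (ℤ.+ w)) (sym (cong₂ ℤ._-_ (ℤ.pos-+ x z) (ℤ.pos-+ y w))))
               (∣m∣n⇒∣m+n d e))
    where regroup : ∀ a b c d → (a ℤ.- b) ℤ.+ (c ℤ.- d) ≡ (a ℤ.+ c) ℤ.- (b ℤ.+ d)
          regroup = ℤ-Solver.solve-∀

  *-congˡ : ∀ k {x y} → x ≋ y → k * x ≋ k * y
  *-congˡ k {x} {y} (mk≋ d) =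
    mk≋ (subst (ℤ.+ p ∣ˢ_) (trans (distrib (ℤ.+ k) (ℤ.+ x) (ℤ.+ y)) (sym (cong₂ ℤ._-_ (ℤ.pos-* k x) (ℤ.pos-* k y))))
               (∣n⇒∣m*n (ℤ.+ k) d))
    where distrib : ∀ a b c → a ℤ.* (b ℤ.- c) ≡ a ℤ.* b ℤ.- a ℤ.* c
          distrib = ℤ-Solver.solve-∀

  *-congʳ : ∀ k {x y} → x ≋ y → x * k ≋ y * k
  *-congʳ k {x} {y} x≋y = ≋-trans (≡⇒≋ (*-comm x k)) (≋-trans (*-congˡ k x≋y) (≡⇒≋ (*-comm k y)))

  +-cancelʳ : ∀ {x y z w} → x + z ≋ y + w → z ≋ w → x ≋ y
  +-cancelʳ {x} {y} {z} {w} (mk≋ d) (mk≋ e) =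
    mk≋ (subst (ℤ.+ p ∣ˢ_) (cancel (ℤ.+ x) (ℤ.+ y) (ℤ.+ z) (ℤ.+ w))
                 (∣m∣n⇒∣m+n (subst (ℤ.+ p ∣ˢ_) (cong₂ ℤ._-_ (ℤ.pos-+ x z) (ℤ.pos-+ y w)) d) (∣m⇒∣-m e)))
    where cancel : ∀ a b c d → ((a ℤ.+ c) ℤ.- (b ℤ.+ d)) ℤ.+ ℤ.- (c ℤ.- d) ≡ a ℤ.- b
          cancel = ℤ-Solver.solve-∀

  p*x≋0 : ∀ x → p * x ≋ 0
  p*x≋0 x = mk≋ (subst (ℤ.+ p ∣ˢ_) (trans (sym (ℤ.pos-* p x)) (sym (ℤ.+-identityʳ (ℤ.+ (p * x)))))
                       (divides (ℤ.+ x) (ℤ.*-comm (ℤ.+ p) (ℤ.+ x))))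

  x+p*y≋x : ∀ x y → x + p * y ≋ x
  x+p*y≋x x y = ≋-trans (+-cong (≋-refl {x}) (p*x≋0 y)) (≡⇒≋ (+-identityʳ x))

  *-zeroʳ≋ : ∀ k {x} → x ≋ 0 → k * x ≋ 0
  *-zeroʳ≋ k {x} x≋0 = ≋-trans (*-congˡ k x≋0) (≡⇒≋ (*-zeroʳ k))

  ∑-cong≋ : ∀ n {f g : ℕ → ℕ} → (∀ i → i < n → f i ≋ g i) → ∑< n f ≋ ∑< n g
  ∑-cong≋ zero    f≋g = ≋-refl
  ∑-cong≋ (suc n) f≋g = +-cong (∑-cong≋ n (λ i i<n → f≋g i (m<n⇒m<1+n i<n))) (f≋g n (n<1+n n))

  ∑-zero≋ : ∀ n {f : ℕ → ℕ} → (∀ i → i < n → f i ≋ 0) → ∑< n f ≋ 0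
  ∑-zero≋ n f≋0 = ≋-trans (∑-cong≋ n f≋0) (≡⇒≋ (∑-zero n (λ _ → 0) (λ _ _ → refl)))

  ∣⇒≋0 : ∀ {x} → p ∣ x → x ≋ 0
  ∣⇒≋0 {x} p∣x = mk≋ (subst (ℤ.+ p ∣ˢ_) (sym (ℤ.+-identityʳ (ℤ.+ x))) (∣ᵤ⇒∣ p∣x))

  ≋0⇒∣ : ∀ {x} → x ≋ 0 → p ∣ x
  ≋0⇒∣ {x} (mk≋ d) = ∣⇒∣ᵤ (subst (ℤ.+ p ∣ˢ_) (ℤ.+-identityʳ (ℤ.+ x)) d)

  ≋⇒∣ℤ : ∀ {x y} → x ≋ y → ℤ.+ p ∣ℤ ℤ.+ x ℤ.- ℤ.+ y
  ≋⇒∣ℤ (mk≋ d) = ∣⇒∣ᵤ d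

  ∣ℤ⇒≋ : ∀ {x y} → ℤ.+ p ∣ℤ ℤ.+ x ℤ.- ℤ.+ y → x ≋ y
  ∣ℤ⇒≋ d = mk≋ (∣ᵤ⇒∣ d)

-- Stirling and Bell numbers

stirling : ℕ → ℕ → ℕ
stirling zero    zero    = 1
stirling zero    (suc k) = 0
stirling (suc n) zero    = 0
stirling (suc n) (suc k) = suc k * stirling n (suc k) + stirling n k

stirling-above : ∀ {n k} → n < k → stirling n k ≡ 0
stirling-above {zero}  {suc k} _         = refl
stirling-above {suc n} {suc k} (s≤s n<k) =
  cong₂ _+_ (trans (cong (suc k *_) (stirling-above (m<n⇒m<1+n n<k))) (*-zeroʳ (suc k))) (stirling-above n<k)

stirling-diag : ∀ n → stirling n n ≡ 1
stirling-diag zero    = refl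
stirling-diag (suc n) = cong₂ _+_ (trans (cong (suc n *_) (stirling-above (n<1+n n))) (*-zeroʳ (suc n))) (stirling-diag n)

falling : ℕ → ℕ → ℕ
falling j zero    = 1
falling j (suc m) = falling j m * (j ∸ m)

falling-above : ∀ {j m} → j < m → falling j m ≡ 0
falling-above {j} {suc m} (s≤s j≤m) with m≤n⇒m<n∨m≡n j≤m
... | inj₁ j<m  = cong (_* (j ∸ m)) (falling-above j<m)
... | inj₂ refl = trans (cong (falling j j *_) (n∸n≡0 j)) (*-zeroʳ (falling j j))

*-falling : ∀ j m → j * falling j m ≡ m * falling j m + falling j (suc m)
*-falling j m with m ≤? j
... | yes m≤j = begin
  j * falling j m                          ≡⟨ cong (_* falling j m) (sym (m+[n∸m]≡n m≤j)) ⟩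
  (m + (j ∸ m)) * falling j m              ≡⟨ *-distribʳ-+ (falling j m) m (j ∸ m) ⟩
  m * falling j m + (j ∸ m) * falling j m  ≡⟨ cong (m * falling j m +_) (*-comm (j ∸ m) (falling j m)) ⟩
  m * falling j m + falling j (suc m)      ∎
  where open ≡-Reasoning
... | no m≰j = begin
  j * falling j m                          ≡⟨ cong (j *_) vanishes ⟩
  j * 0                                    ≡⟨ trans (*-zeroʳ j) (sym (trans (+-identityʳ (m * 0)) (*-zeroʳ m))) ⟩
  m * 0 + 0 * (j ∸ m)                      ≡⟨ cong₂ (λ a b → m * a + b * (j ∸ m)) (sym vanishes) (sym vanishes) ⟩
  m * falling j m + falling j (suc m)      ∎
  where
  open ≡-Reasoning
  vanishes : falling j m ≡ 0
  vanishes = falling-above (≰⇒> m≰j)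

power-stirling-expansion : ∀ j n → j ^ n ≡ ∑[ m < suc n ] (falling j m * stirling n m)
power-stirling-expansion j zero    = refl
power-stirling-expansion j (suc n) = begin
  j * j ^ n
    ≡⟨ cong (j *_) (power-stirling-expansion j n) ⟩
  j * ∑[ m < suc n ] (falling j m * stirling n m)
    ≡⟨ sym (∑-distribˡ-* (suc n) j _) ⟩
  ∑[ m < suc n ] (j * (falling j m * stirling n m))
    ≡⟨ ∑-cong (suc n) (λ m _ → step m) ⟩
  ∑[ m < suc n ] (m * falling j m * stirling n m + falling j (suc m) * stirling n m)
    ≡⟨ ∑-distrib-+ (suc n) _ _ ⟩
  ∑[ m < suc n ] (m * falling j m * stirling n m) + ∑[ m < suc n ] (falling j (suc m) * stirling n m)
    ≡⟨ cong (_+ ∑[ m < suc n ] (falling j (suc m) * stirling n m)) reindex ⟩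
  ∑< (suc n) shifted + ∑[ m < suc n ] (falling j (suc m) * stirling n m)
    ≡⟨ sym (∑-distrib-+ (suc n) shifted _) ⟩
  ∑[ m < suc n ] (shifted m + falling j (suc m) * stirling n m)
    ≡⟨ ∑-cong (suc n) (λ m _ → factor (suc m) (falling j (suc m)) (stirling n (suc m)) (stirling n m)) ⟩
  ∑[ m < suc n ] (falling j (suc m) * stirling (suc n) (suc m))
    ≡⟨ sym (∑-head (suc n) (λ m → falling j m * stirling (suc n) m)) ⟩
  ∑[ m < suc (suc n) ] (falling j m * stirling (suc n) m)
    ∎
  where
  open ≡-Reasoning
  shifted : ℕ → ℕ
  shifted m = suc m * falling j (suc m) * stirling n (suc m)
  step : ∀ m → j * (falling j m * stirling n m) ≡ m * falling j m * stirling n m + falling j (suc m) * stirling n m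
  step m = trans (sym (*-assoc j (falling j m) (stirling n m)))
                 (trans (cong (_* stirling n m) (*-falling j m)) (*-distribʳ-+ (stirling n m) (m * falling j m) _))
  top-vanishes : shifted n ≡ 0
  top-vanishes = trans (cong (suc n * falling j (suc n) *_) (stirling-above (n<1+n n))) (*-zeroʳ (suc n * falling j (suc n)))
  reindex : ∑[ m < suc n ] (m * falling j m * stirling n m) ≡ ∑< (suc n) shifted
  reindex = begin
    ∑[ m < suc n ] (m * falling j m * stirling n m)   ≡⟨ ∑-head n _ ⟩
    ∑< n shifted                                      ≡⟨ sym (+-identityʳ _) ⟩
    ∑< n shifted + 0                                  ≡⟨ cong (∑< n shifted +_) (sym top-vanishes) ⟩
    ∑< (suc n) shifted                                ∎
  factor : ∀ a b c d → a * b * c + b * d ≡ b * (a * c + d)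
  factor = solve-∀

bell : ℕ → ℕ
bell n = ∑< (suc n) (stirling n)

bell-truncate : ∀ {i m} → i ≤ m → ∑< (suc m) (stirling i) ≡ bell i
bell-truncate i≤m = ∑-truncate _ (s≤s i≤m) (λ _ i<k → stirling-above i<k)

stirling-binomial : ∀ n k → stirling (suc n) (suc k) ≡ ∑[ i < suc n ] ((n C i) * stirling i k)
stirling-binomial zero    k = trans (cong (_+ stirling 0 k) (trans (cong (suc k *_) (stirling-above {0} {suc k} (s≤s z≤n))) (*-zeroʳ (suc k))))
                                    (sym (+-identityʳ (stirling 0 k)))
stirling-binomial (suc n) k = begin
  suc k * stirling (suc n) (suc k) + stirling (suc n) k
    ≡⟨ +-assoc (stirling (suc n) (suc k)) (k * stirling (suc n) (suc k)) _ ⟩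
  stirling (suc n) (suc k) + (k * stirling (suc n) (suc k) + stirling (suc n) k)
    ≡⟨ cong₂ _+_ (stirling-binomial n k) (sym (shifted k)) ⟩
  ∑[ i < suc n ] ((n C i) * stirling i k) + ∑[ i < suc n ] ((n C i) * stirling (suc i) k)
    ≡⟨ sym (∑-pascal n (λ i → stirling i k)) ⟩
  ∑[ i < suc (suc n) ] ((suc n C i) * stirling i k)
    ∎
  where
  open ≡-Reasoning
  shifted : ∀ k → ∑[ i < suc n ] ((n C i) * stirling (suc i) k) ≡ k * stirling (suc n) (suc k) + stirling (suc n) k
  shifted zero    = ∑-zero (suc n) _ (λ i _ → *-zeroʳ (n C i))
  shifted (suc k) = begin
    ∑[ i < suc n ] ((n C i) * (suc k * stirling i (suc k) + stirling i k))
      ≡⟨ ∑-cong (suc n) (λ i _ → distribute (n C i) (suc k) (stirling i (suc k)) (stirling i k)) ⟩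
    ∑[ i < suc n ] (suc k * ((n C i) * stirling i (suc k)) + (n C i) * stirling i k)
      ≡⟨ ∑-distrib-+ (suc n) _ _ ⟩
    ∑[ i < suc n ] (suc k * ((n C i) * stirling i (suc k))) + ∑[ i < suc n ] ((n C i) * stirling i k)
      ≡⟨ cong₂ _+_ (trans (∑-distribˡ-* (suc n) (suc k) _) (cong (suc k *_) (sym (stirling-binomial n (suc k)))))
                   (sym (stirling-binomial n k)) ⟩
    suc k * stirling (suc n) (suc (suc k)) + stirling (suc n) (suc k)
      ∎
    where distribute : ∀ a b c d → a * (b * c + d) ≡ b * (a * c) + a * d
          distribute = solve-∀

bell-recurrence : ∀ m → bell (suc m) ≡ ∑[ i < suc m ] ((m C i) * bell i)
bell-recurrence m = begin
  ∑< (suc (suc m)) (stirling (suc m))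
    ≡⟨ ∑-head (suc m) (stirling (suc m)) ⟩
  ∑[ k < suc m ] stirling (suc m) (suc k)
    ≡⟨ ∑-cong (suc m) (λ k _ → stirling-binomial m k) ⟩
  ∑[ k < suc m ] ∑[ i < suc m ] ((m C i) * stirling i k)
    ≡⟨ ∑-comm (suc m) (suc m) _ ⟩
  ∑[ i < suc m ] ∑[ k < suc m ] ((m C i) * stirling i k)
    ≡⟨ ∑-cong (suc m) (λ i i≤m → trans (∑-distribˡ-* (suc m) (m C i) (stirling i))
                                       (cong ((m C i) *_) (bell-truncate (≤-pred i≤m)))) ⟩
  ∑[ i < suc m ] ((m C i) * bell i)
    ∎
  where open ≡-Reasoning

-- Fermat's little theorem and Touchard's congruence

module ModuloPrime {q : ℕ} (p-prime : Prime (suc (suc q))) where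

  p : ℕ
  p = suc (suc q)

  open Modular p public

  0<m<p⇒∤ : ∀ {m} → 0 < m → m < p → ¬ p ∣ m
  0<m<p⇒∤ {suc m} _ m<p p∣m = <⇒≱ m<p (∣⇒≤ p∣m)

  *-cancelˡ : ∀ m {x y} → ¬ p ∣ m → m * x ≋ m * y → x ≋ y
  *-cancelˡ m {x} {y} p∤m (mk≋ d) = [ ⊥-elim ∘ p∤m , ∣ℤ⇒≋ ]′ (euclidsLemma m ℤ.∣ ℤ.+ x ℤ.- ℤ.+ y ∣ p-prime p∣m∣x-y∣)
    where
    factor : ∀ a b c → a ℤ.* b ℤ.- a ℤ.* c ≡ a ℤ.* (b ℤ.- c)
    factor = ℤ-Solver.solve-∀
    p∣m∣x-y∣ : p ∣ m * ℤ.∣ ℤ.+ x ℤ.- ℤ.+ y ∣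
    p∣m∣x-y∣ = subst (p ∣_) (ℤ.abs-* (ℤ.+ m) (ℤ.+ x ℤ.- ℤ.+ y))
      (∣⇒∣ᵤ (subst (ℤ.+ p ∣ˢ_) (trans (cong₂ ℤ._-_ (ℤ.pos-* m x) (ℤ.pos-* m y)) (factor (ℤ.+ m) (ℤ.+ x) (ℤ.+ y))) d))

  pC[1+i]≋0 : ∀ {i} → i < suc q → p C suc i ≋ 0
  pC[1+i]≋0 {i} i<p-1 = *-cancelˡ (suc i) (0<m<p⇒∤ (s≤s z≤n) (s≤s i<p-1)) (begin
    suc i * (p C suc i)  ≡⟨ [1+n]C[1+k]-absorption (suc q) i ⟩
    p * (suc q C i)      ≈⟨ p*x≋0 (suc q C i) ⟩
    0                    ≡⟨ sym (*-zeroʳ (suc i)) ⟩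
    suc i * 0            ∎)
    where open ≋-Reasoning

  ∑-binomial-p : ∀ (x : ℕ → ℕ) → ∑[ i < suc p ] ((p C i) * x i) ≋ x 0 + x p
  ∑-binomial-p x = +-cong inner (≡⇒≋ (trans (cong (_* x p) (nCn≡1 p)) (*-identityˡ (x p))))
    where
    open ≋-Reasoning
    inner : ∑[ i < p ] ((p C i) * x i) ≋ x 0
    inner = begin
      ∑[ i < p ] ((p C i) * x i)                               ≡⟨ ∑-head (suc q) _ ⟩
      1 * x 0 + ∑[ i < suc q ] ((p C suc i) * x (suc i))
        ≈⟨ +-cong ≋-refl (∑-zero≋ (suc q) (λ i i<p-1 → *-congʳ (x (suc i)) (pC[1+i]≋0 i<p-1))) ⟩
      1 * x 0 + 0                                              ≡⟨ trans (+-identityʳ _) (*-identityˡ (x 0)) ⟩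
      x 0                                                      ∎

  fermat : ∀ a → a ^ p ≋ a
  fermat zero    = ≋-refl
  fermat (suc a) = begin
    suc a ^ p                           ≡⟨ binomial-theorem a p ⟩
    ∑[ i < suc p ] ((p C i) * a ^ i)    ≈⟨ ∑-binomial-p (a ^_) ⟩
    1 + a ^ p                           ≈⟨ +-cong (≋-refl {1}) (fermat a) ⟩
    suc a                               ∎
    where open ≋-Reasoning

  falling-∤ : ∀ {j} → j < p → ∀ m → m ≤ j → ¬ p ∣ falling j m
  falling-∤ j<p zero    _   p∣1 = <⇒≱ (s≤s (s≤s z≤n)) (∣⇒≤ p∣1)
  falling-∤ {j} j<p (suc m) m<j p∣f with euclidsLemma (falling j m) (j ∸ m) p-prime p∣f
  ... | inj₁ p∣falling = falling-∤ j<p m (<⇒≤ m<j) p∣falling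
  ... | inj₂ p∣j-m     = 0<m<p⇒∤ (m<n⇒0<n∸m m<j) (≤-<-trans (m∸n≤m j m) j<p) p∣j-m

  ∑-falling-truncate : ∀ {j} → j < p → (X : ℕ → ℕ) →
    ∑[ m < suc p ] (falling j m * X m) ≡ ∑[ m < j ] (falling j m * X m) + falling j j * X j
  ∑-falling-truncate j<p X = ∑-truncate _ (s≤s (<⇒≤ j<p)) (λ i j<i → cong (_* X i) (falling-above j<i))

  -- Fermat says j^p ≡ j^1; expanding both in falling factorials gives a triangular
  -- system whose diagonal coefficients (j)_j are units mod p.
  stirling-p≋stirling-1 : ∀ j → j < p → stirling p j ≋ stirling 1 j
  stirling-p≋stirling-1 = <-rec (λ j → j < p → stirling p j ≋ stirling 1 j) step
    where
    expansions≋ : ∀ j → ∑[ m < suc p ] (falling j m * stirling p m) ≋ ∑[ m < suc p ] (falling j m * stirling 1 m)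
    expansions≋ j = begin
      ∑[ m < suc p ] (falling j m * stirling p m)  ≡⟨ sym (power-stirling-expansion j p) ⟩
      j ^ p                                        ≈⟨ fermat j ⟩
      j                                            ≡⟨ sym (*-identityʳ j) ⟩
      j ^ 1                                        ≡⟨ power-stirling-expansion j 1 ⟩
      ∑[ m < 2 ] (falling j m * stirling 1 m)      ≡⟨ sym (∑-truncate {2} {suc p} _ (s≤s (s≤s z≤n)) above-1) ⟩
      ∑[ m < suc p ] (falling j m * stirling 1 m)  ∎
      where
      open ≋-Reasoning
      above-1 : ∀ i → 2 ≤ i → falling j i * stirling 1 i ≡ 0
      above-1 i 2≤i = trans (cong (falling j i *_) (stirling-above 2≤i)) (*-zeroʳ (falling j i))
    step : ∀ j → (∀ {i} → i < j → i < p → stirling p i ≋ stirling 1 i) → j < p → stirling p j ≋ stirling 1 j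
    step j ih j<p = *-cancelˡ (falling j j) (falling-∤ j<p j ≤-refl) (+-cancelʳ diagonal lower)
      where
      open ≋-Reasoning
      lower : ∑[ m < j ] (falling j m * stirling p m) ≋ ∑[ m < j ] (falling j m * stirling 1 m)
      lower = ∑-cong≋ j (λ m m<j → *-congˡ (falling j m) (ih m<j (<-trans m<j j<p)))
      diagonal : falling j j * stirling p j + ∑[ m < j ] (falling j m * stirling p m)
               ≋ falling j j * stirling 1 j + ∑[ m < j ] (falling j m * stirling 1 m)
      diagonal = begin
        falling j j * stirling p j + ∑[ m < j ] (falling j m * stirling p m)  ≡⟨ +-comm (falling j j * stirling p j) _ ⟩
        ∑[ m < j ] (falling j m * stirling p m) + falling j j * stirling p j  ≡⟨ sym (∑-falling-truncate j<p (stirling p)) ⟩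
        ∑[ m < suc p ] (falling j m * stirling p m)                           ≈⟨ expansions≋ j ⟩
        ∑[ m < suc p ] (falling j m * stirling 1 m)                           ≡⟨ ∑-falling-truncate j<p (stirling 1) ⟩
        ∑[ m < j ] (falling j m * stirling 1 m) + falling j j * stirling 1 j  ≡⟨ +-comm (∑[ m < j ] (falling j m * stirling 1 m)) _ ⟩
        falling j j * stirling 1 j + ∑[ m < j ] (falling j m * stirling 1 m)  ∎

  StirlingShiftBelow StirlingShiftAbove : ℕ → Set
  StirlingShiftBelow n = ∀ k → k < p → stirling (n + p) k ≋ stirling (suc n) k
  StirlingShiftAbove n = ∀ t → stirling (n + p) (t + p) ≋ stirling (suc n) (t + p) + stirling n t

  stirling-shift : ∀ n → StirlingShiftBelow n × StirlingShiftAbove n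
  stirling-shift zero    = (λ k k<p → stirling-p≋stirling-1 k k<p) , base
    where
    base : StirlingShiftAbove 0
    base zero    = ≡⇒≋ (trans (stirling-diag p) (cong (_+ 1) (sym (stirling-above {1} {p} (s≤s (s≤s z≤n))))))
    base (suc t) = ≡⇒≋ (trans (stirling-above (s≤s (m≤n+m p t)))
                              (sym (cong (_+ 0) (stirling-above {1} (s≤s (≤-trans (s≤s z≤n) (m≤n+m p t)))))))
  stirling-shift (suc n) = below , above
    where
    open ≋-Reasoning
    below-ih : StirlingShiftBelow n
    below-ih = proj₁ (stirling-shift n)
    above-ih : StirlingShiftAbove n
    above-ih = proj₂ (stirling-shift n)
    below : StirlingShiftBelow (suc n)
    below zero    _   = ≋-refl
    below (suc k) k<p = +-cong (*-congˡ (suc k) (below-ih (suc k) k<p)) (below-ih k (<-trans (n<1+n k) k<p))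
    above : StirlingShiftAbove (suc n)
    above zero    = begin
      p * stirling (n + p) p + stirling (n + p) (suc q)         ≈⟨ +-cong (≋-refl {p * stirling (n + p) p}) (below-ih (suc q) ≤-refl) ⟩
      p * stirling (n + p) p + stirling (suc n) (suc q)         ≡⟨ +-comm (p * stirling (n + p) p) _ ⟩
      stirling (suc n) (suc q) + p * stirling (n + p) p         ≈⟨ x+p*y≋x (stirling (suc n) (suc q)) (stirling (n + p) p) ⟩
      stirling (suc n) (suc q)                                  ≈⟨ ≋-sym (x+p*y≋x (stirling (suc n) (suc q)) (stirling (suc n) p)) ⟩
      stirling (suc n) (suc q) + p * stirling (suc n) p         ≡⟨ regroup (stirling (suc n) (suc q)) (p * stirling (suc n) p) ⟩
      p * stirling (suc n) p + stirling (suc n) (suc q) + 0     ∎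
      where regroup : ∀ a b → a + b ≡ (b + a) + 0
            regroup = solve-∀
    above (suc t) = begin
      suc (t + p) * stirling (n + p) (suc t + p) + stirling (n + p) (t + p)
        ≈⟨ +-cong (*-congˡ (suc (t + p)) (above-ih (suc t))) (above-ih t) ⟩
      suc (t + p) * (stirling (suc n) (suc t + p) + stirling n (suc t)) + (stirling (suc n) (t + p) + stirling n t)
        ≡⟨ regroup t p (stirling (suc n) (suc (t + p))) (stirling n (suc t)) (stirling (suc n) (t + p)) (stirling n t) ⟩
      (suc (t + p) * stirling (suc n) (suc t + p) + stirling (suc n) (t + p)) + (suc t * stirling n (suc t) + stirling n t) + p * stirling n (suc t)
        ≈⟨ x+p*y≋x _ (stirling n (suc t)) ⟩
      (suc (t + p) * stirling (suc n) (suc t + p) + stirling (suc n) (t + p)) + (suc t * stirling n (suc t) + stirling n t)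
        ∎
      where regroup : ∀ s P a b c d → suc (s + P) * (a + b) + (c + d) ≡ ((suc (s + P) * a + c) + (suc s * b + d)) + P * b
            regroup = solve-∀

  touchard : ∀ n → bell (n + p) ≋ bell (suc n) + bell n
  touchard n = begin
    bell (n + p)
      ≡⟨ cong (λ m → ∑< m (stirling (n + p))) (sym (trans (+-suc p n) (cong suc (+-comm p n)))) ⟩
    ∑< (p + suc n) (stirling (n + p))
      ≡⟨ ∑-split p (suc n) _ ⟩
    ∑< p (stirling (n + p)) + ∑[ t < suc n ] stirling (n + p) (p + t)
      ≈⟨ +-cong (∑-cong≋ p (proj₁ (stirling-shift n))) (∑-cong≋ (suc n) (λ t _ → above t)) ⟩
    ∑< p (stirling (suc n)) + ∑[ t < suc n ] (stirling (suc n) (p + t) + stirling n t)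
      ≡⟨ cong (∑< p (stirling (suc n)) +_) (∑-distrib-+ (suc n) _ _) ⟩
    ∑< p (stirling (suc n)) + (∑[ t < suc n ] stirling (suc n) (p + t) + bell n)
      ≡⟨ sym (+-assoc (∑< p (stirling (suc n))) _ _) ⟩
    ∑< p (stirling (suc n)) + ∑[ t < suc n ] stirling (suc n) (p + t) + bell n
      ≡⟨ cong (_+ bell n) (sym (∑-split p (suc n) _)) ⟩
    ∑< (p + suc n) (stirling (suc n)) + bell n
      ≡⟨ cong (_+ bell n) (∑-truncate _ (s≤s (s≤s (≤-trans (n≤1+n n) (m≤n+m (suc n) q)))) (λ _ → stirling-above)) ⟩
    bell (suc n) + bell n
      ∎
    where
    open ≋-Reasoning
    above : ∀ t → stirling (n + p) (p + t) ≋ stirling (suc n) (p + t) + stirling n t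
    above t = begin
      stirling (n + p) (p + t)                        ≡⟨ cong (stirling (n + p)) (+-comm p t) ⟩
      stirling (n + p) (t + p)                        ≈⟨ proj₂ (stirling-shift n) t ⟩
      stirling (suc n) (t + p) + stirling n t         ≡⟨ cong (λ s → stirling (suc n) s + stirling n t) (+-comm t p) ⟩
      stirling (suc n) (p + t) + stirling n t         ∎

  vanishing⇔congruent : (b : ℕ → ℕ) → (∀ m → b (p * m) ≋ ∑[ i < suc m ] ((m C i) * b i)) →
    (∀ m → m ≤ q → p ∣ b m) ⇔ (∀ m → 1 ≤ m → m ≤ suc q → b m ≋ b (p * m))
  vanishing⇔congruent b expand = mk⇔ to from
    where
    open ≋-Reasoning
    to : (∀ m → m ≤ q → p ∣ b m) → ∀ m → 1 ≤ m → m ≤ suc q → b m ≋ b (p * m)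
    to vanish m _ m≤p-1 = ≋-sym (begin
      b (p * m)                                      ≈⟨ expand m ⟩
      ∑[ i < m ] ((m C i) * b i) + (m C m) * b m     ≈⟨ +-cong lower (≡⇒≋ (trans (cong (_* b m) (nCn≡1 m)) (*-identityˡ (b m)))) ⟩
      b m                                            ∎)
      where
      lower : ∑[ i < m ] ((m C i) * b i) ≋ 0
      lower = ∑-zero≋ m (λ i i<m → *-zeroʳ≋ (m C i) (∣⇒≋0 (vanish i (≤-pred (≤-trans i<m m≤p-1)))))
    -- In b (p (i+1)) ≡ Σ_{i' ≤ i+1} C(i+1,i') b i', the terms below i vanish by induction
    -- and the top term is b (i+1), which leaves (i+1) b i ≡ 0 with i+1 a unit mod p.
    from : (∀ m → 1 ≤ m → m ≤ suc q → b m ≋ b (p * m)) → ∀ m → m ≤ q → p ∣ b m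
    from congruent m m≤q = ≋0⇒∣ (<-rec (λ m → m ≤ q → b m ≋ 0) step m m≤q)
      where
      step : ∀ i → (∀ {i'} → i' < i → i' ≤ q → b i' ≋ 0) → i ≤ q → b i ≋ 0
      step i ih i≤q = *-cancelˡ (suc i) (0<m<p⇒∤ (s≤s z≤n) (s≤s (s≤s i≤q))) (+-cancelʳ expansion ≋-refl)
        where
        lower : ∑[ i' < i ] ((suc i C i') * b i') ≋ 0
        lower = ∑-zero≋ i (λ i' i'<i → *-zeroʳ≋ (suc i C i') (ih i'<i (≤-trans (<⇒≤ i'<i) i≤q)))
        expansion : suc i * b i + b (suc i) ≋ suc i * 0 + b (suc i)
        expansion = begin
          suc i * b i + b (suc i)
            ≡⟨ cong₂ _+_ (cong (_* b i) (sym ([1+n]Cn≡1+n i))) (sym (trans (cong (_* b (suc i)) (nCn≡1 (suc i))) (*-identityˡ _))) ⟩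
          (0 + (suc i C i) * b i) + (suc i C suc i) * b (suc i)
            ≈⟨ +-cong (+-cong (≋-sym lower) ≋-refl) ≋-refl ⟩
          ∑[ i' < suc (suc i) ] ((suc i C i') * b i')
            ≈⟨ ≋-sym (expand (suc i)) ⟩
          b (p * suc i)
            ≈⟨ ≋-sym (congruent (suc i) (s≤s z≤n) (s≤s i≤q)) ⟩
          b (suc i)
            ≡⟨ cong (_+ b (suc i)) (sym (*-zeroʳ (suc i))) ⟩
          suc i * 0 + b (suc i)
            ∎

module BellTable (g : ℕ → ℕ → ℕ)
                 (g-suc : ∀ k j → g (suc k) j ≡ g k (suc j) + g k j)
                 (g-bell : ∀ k → g k 0 ≡ bell k) where

  bell-binomial : ∀ j k → bell (k + j) ≡ ∑[ i < suc j ] ((j C i) * g k i)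
  bell-binomial zero    k = trans (cong bell (+-identityʳ k)) (trans (sym (g-bell k)) (sym (+-identityʳ (g k 0))))
  bell-binomial (suc j) k = begin
    bell (k + suc j)
      ≡⟨ cong bell (+-suc k j) ⟩
    bell (suc k + j)
      ≡⟨ bell-binomial j (suc k) ⟩
    ∑[ i < suc j ] ((j C i) * g (suc k) i)
      ≡⟨ ∑-cong (suc j) (λ i _ → trans (cong ((j C i) *_) (trans (g-suc k i) (+-comm (g k (suc i)) (g k i))))
                                       (*-distribˡ-+ (j C i) (g k i) (g k (suc i)))) ⟩
    ∑[ i < suc j ] ((j C i) * g k i + (j C i) * g k (suc i))
      ≡⟨ ∑-distrib-+ (suc j) _ _ ⟩
    ∑[ i < suc j ] ((j C i) * g k i) + ∑[ i < suc j ] ((j C i) * g k (suc i))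
      ≡⟨ sym (∑-pascal j (g k)) ⟩
    ∑[ i < suc (suc j) ] ((suc j C i) * g k i)
      ∎
    where open ≡-Reasoning

  module _ {q : ℕ} (p-prime : Prime (suc (suc q))) where

    open ModuloPrime p-prime
    open ≋-Reasoning

    g-p≋bell : ∀ k → g k p ≋ bell (suc k)
    g-p≋bell k = +-cancelʳ (begin
      g k p + bell k                      ≡⟨ cong (g k p +_) (sym (g-bell k)) ⟩
      g k p + g k 0                       ≡⟨ +-comm (g k p) (g k 0) ⟩
      g k 0 + g k p                       ≈⟨ ≋-sym (∑-binomial-p (g k)) ⟩
      ∑[ i < suc p ] ((p C i) * g k i)    ≡⟨ sym (bell-binomial p k) ⟩
      bell (k + p)                        ≈⟨ touchard k ⟩
      bell (suc k) + bell k               ∎) ≋-refl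

    g-shift : ∀ j k → g k (j + p) ≋ g k j + g k (suc j)
    g-shift zero    k = begin
      g k p               ≈⟨ g-p≋bell k ⟩
      bell (suc k)        ≡⟨ sym (g-bell (suc k)) ⟩
      g (suc k) 0         ≡⟨ g-suc k 0 ⟩
      g k 1 + g k 0       ≡⟨ +-comm (g k 1) (g k 0) ⟩
      g k 0 + g k 1       ∎
    g-shift (suc j) k = +-cancelʳ (begin
      g k (suc j + p) + g k (j + p)
        ≡⟨ sym (g-suc k (j + p)) ⟩
      g (suc k) (j + p)
        ≈⟨ g-shift j (suc k) ⟩
      g (suc k) j + g (suc k) (suc j)
        ≡⟨ cong₂ _+_ (g-suc k j) (g-suc k (suc j)) ⟩
      (g k (suc j) + g k j) + (g k (suc (suc j)) + g k (suc j))
        ≡⟨ regroup (g k (suc j)) (g k j) (g k (suc (suc j))) ⟩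
      (g k (suc j) + g k (suc (suc j))) + (g k j + g k (suc j))
        ∎) (g-shift j k)
      where regroup : ∀ a b c → (a + b) + (c + a) ≡ (a + c) + (b + a)
            regroup = solve-∀

    g-shift-multiple : ∀ k m j → g k (j + p * m) ≋ ∑[ i < suc m ] ((m C i) * g k (j + i))
    g-shift-multiple k zero    j = ≡⇒≋ (trans (cong (λ z → g k (j + z)) (*-zeroʳ p)) (sym (+-identityʳ (g k (j + 0)))))
    g-shift-multiple k (suc m) j = begin
      g k (j + p * suc m)
        ≡⟨ cong (g k) (regroup j p m) ⟩
      g k ((j + p) + p * m)
        ≈⟨ g-shift-multiple k m (j + p) ⟩
      ∑[ i < suc m ] ((m C i) * g k ((j + p) + i))
        ≈⟨ ∑-cong≋ (suc m) (λ i _ → *-congˡ (m C i) (shifted i)) ⟩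
      ∑[ i < suc m ] ((m C i) * (g k (j + i) + g k (j + suc i)))
        ≡⟨ ∑-cong (suc m) (λ i _ → *-distribˡ-+ (m C i) (g k (j + i)) (g k (j + suc i))) ⟩
      ∑[ i < suc m ] ((m C i) * g k (j + i) + (m C i) * g k (j + suc i))
        ≡⟨ ∑-distrib-+ (suc m) _ _ ⟩
      ∑[ i < suc m ] ((m C i) * g k (j + i)) + ∑[ i < suc m ] ((m C i) * g k (j + suc i))
        ≡⟨ sym (∑-pascal m (λ i → g k (j + i))) ⟩
      ∑[ i < suc (suc m) ] ((suc m C i) * g k (j + i))
        ∎
      where
      regroup : ∀ a b c → a + b * suc c ≡ (a + b) + b * c
      regroup = solve-∀
      shifted : ∀ i → g k ((j + p) + i) ≋ g k (j + i) + g k (j + suc i)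
      shifted i = begin
        g k ((j + p) + i)             ≡⟨ cong (g k) (x+y+z≡x+z+y j p i) ⟩
        g k ((j + i) + p)             ≈⟨ g-shift (j + i) k ⟩
        g k (j + i) + g k (suc (j + i)) ≡⟨ cong (λ z → g k (j + i) + g k z) (sym (+-suc j i)) ⟩
        g k (j + i) + g k (j + suc i) ∎
        where x+y+z≡x+z+y : ∀ x y z → (x + y) + z ≡ (x + z) + y
              x+y+z≡x+z+y = solve-∀

false≢true : false ≢ true
false≢true ()

χ : Bool → ℕ
χ true  = 1
χ false = 0

χ? : ∀ {ℓ} {P : Set ℓ} → Dec P → ℕ
χ? d = χ (does d)

χ?-cong : ∀ {ℓ ℓ′} {P : Set ℓ} {Q : Set ℓ′} → (P → Q) → (Q → P) → (p? : Dec P) (q? : Dec Q) → χ? p? ≡ χ? q?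
χ?-cong P→Q Q→P (yes p) (yes q) = refl
χ?-cong P→Q Q→P (yes p) (no ¬q) = ⊥-elim (¬q (P→Q p))
χ?-cong P→Q Q→P (no ¬p) (yes q) = ⊥-elim (¬p (Q→P q))
χ?-cong P→Q Q→P (no ¬p) (no ¬q) = refl

χ?-no : ∀ {ℓ} {P : Set ℓ} → ¬ P → (p? : Dec P) → χ? p? ≡ 0
χ?-no ¬p (yes p) = ⊥-elim (¬p p)
χ?-no ¬p (no _)  = refl

χ?-yes : ∀ {ℓ} {P : Set ℓ} → P → (p? : Dec P) → χ? p? ≡ 1
χ?-yes p (yes _) = refl
χ?-yes p (no ¬p) = ⊥-elim (¬p p)

χ?-split : ∀ {ℓ ℓ′} {P : Set ℓ} {Q : Set ℓ′} (b : Bool) → (P → b ≡ true × Q) → (b ≡ true → Q → P) →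
           (p? : Dec P) (q? : Dec Q) → χ? p? ≡ χ b * χ? q?
χ?-split true  P→Q Q→P p? q? = trans (χ?-cong (proj₂ ∘ P→Q) (Q→P refl) p? q?) (sym (+-identityʳ _))
χ?-split false P→Q Q→P p? q? = χ?-no (λ p → false≢true (proj₁ (P→Q p))) p?

∑ₗ : List X → (X → ℕ) → ℕ
∑ₗ []       f = 0
∑ₗ (x ∷ xs) f = f x + ∑ₗ xs f

syntax ∑ₗ xs (λ x → e) = ∑[ x ← xs ] e

∑ₗ-++ : (xs ys : List X) (f : X → ℕ) → ∑ₗ (xs ++ ys) f ≡ ∑ₗ xs f + ∑ₗ ys f
∑ₗ-++ []       ys f = refl
∑ₗ-++ (x ∷ xs) ys f = trans (cong (f x +_) (∑ₗ-++ xs ys f)) (sym (+-assoc (f x) _ _))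

∑ₗ-map : (g : X → Y) (xs : List X) (f : Y → ℕ) → ∑ₗ (map g xs) f ≡ ∑ₗ xs (f ∘ g)
∑ₗ-map g []       f = refl
∑ₗ-map g (x ∷ xs) f = cong (f (g x) +_) (∑ₗ-map g xs f)

∑ₗ-cong : (xs : List X) {f g : X → ℕ} → (∀ x → f x ≡ g x) → ∑ₗ xs f ≡ ∑ₗ xs g
∑ₗ-cong []       f≡g = refl
∑ₗ-cong (x ∷ xs) f≡g = cong₂ _+_ (f≡g x) (∑ₗ-cong xs f≡g)

∑ₗ-zero : (xs : List X) (f : X → ℕ) → (∀ x → f x ≡ 0) → ∑ₗ xs f ≡ 0
∑ₗ-zero []       f f≡0 = refl
∑ₗ-zero (x ∷ xs) f f≡0 = cong₂ _+_ (f≡0 x) (∑ₗ-zero xs f f≡0)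

∑ₗ-distrib-+ : (xs : List X) (f g : X → ℕ) → ∑[ x ← xs ] (f x + g x) ≡ ∑ₗ xs f + ∑ₗ xs g
∑ₗ-distrib-+ []       f g = refl
∑ₗ-distrib-+ (x ∷ xs) f g = trans (cong (f x + g x +_) (∑ₗ-distrib-+ xs f g)) (+-interchange (f x) (g x) _ _)

∑ₗ-distribˡ-* : (xs : List X) (k : ℕ) (f : X → ℕ) → ∑[ x ← xs ] (k * f x) ≡ k * ∑ₗ xs f
∑ₗ-distribˡ-* []       k f = sym (*-zeroʳ k)
∑ₗ-distribˡ-* (x ∷ xs) k f = trans (cong (k * f x +_) (∑ₗ-distribˡ-* xs k f)) (sym (*-distribˡ-+ k (f x) _))

length-filter≡∑χ : ∀ {P : X → Set} (P? : Decidable P) (xs : List X) → length (filter P? xs) ≡ ∑[ x ← xs ] χ? (P? x)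
length-filter≡∑χ P? []       = refl
length-filter≡∑χ P? (x ∷ xs) with does (P? x)
... | true  = cong suc (length-filter≡∑χ P? xs)
... | false = length-filter≡∑χ P? xs

∑-sublists-++ : (xs ys : List X) (h : List X → ℕ) →
  ∑ₗ (sublists (xs ++ ys)) h ≡ ∑[ as ← sublists xs ] ∑[ bs ← sublists ys ] h (as ++ bs)
∑-sublists-++ []       ys h = sym (+-identityʳ _)
∑-sublists-++ {X = X} (x ∷ xs) ys h = begin
  ∑ₗ (map (x ∷_) (sublists (xs ++ ys)) ++ sublists (xs ++ ys)) h
    ≡⟨ ∑ₗ-++ (map (x ∷_) (sublists (xs ++ ys))) _ h ⟩
  ∑ₗ (map (x ∷_) (sublists (xs ++ ys))) h + ∑ₗ (sublists (xs ++ ys)) h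
    ≡⟨ cong₂ _+_ (trans (∑ₗ-map (x ∷_) (sublists (xs ++ ys)) h) (∑-sublists-++ xs ys (h ∘ (x ∷_)))) (∑-sublists-++ xs ys h) ⟩
  ∑[ as ← sublists xs ] F (x ∷ as) + ∑ₗ (sublists xs) F
    ≡⟨ cong (_+ ∑ₗ (sublists xs) F) (sym (∑ₗ-map (x ∷_) (sublists xs) F)) ⟩
  ∑ₗ (map (x ∷_) (sublists xs)) F + ∑ₗ (sublists xs) F
    ≡⟨ sym (∑ₗ-++ (map (x ∷_) (sublists xs)) (sublists xs) F) ⟩
  ∑ₗ (sublists (x ∷ xs)) F
    ∎
  where
  open ≡-Reasoning
  F : List X → ℕ
  F as = ∑[ bs ← sublists ys ] h (as ++ bs)

∑-sublists-map : (g : X → Y) (xs : List X) (h : List Y → ℕ) →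
  ∑ₗ (sublists (map g xs)) h ≡ ∑ₗ (sublists xs) (h ∘ map g)
∑-sublists-map g []       h = refl
∑-sublists-map g (x ∷ xs) h = begin
  ∑ₗ (map (g x ∷_) (sublists (map g xs)) ++ sublists (map g xs)) h
    ≡⟨ ∑ₗ-++ (map (g x ∷_) (sublists (map g xs))) _ h ⟩
  ∑ₗ (map (g x ∷_) (sublists (map g xs))) h + ∑ₗ (sublists (map g xs)) h
    ≡⟨ cong₂ _+_ (trans (∑ₗ-map (g x ∷_) (sublists (map g xs)) h) (∑-sublists-map g xs (h ∘ (g x ∷_)))) (∑-sublists-map g xs h) ⟩
  ∑[ as ← sublists xs ] h (g x ∷ map g as) + ∑ₗ (sublists xs) (h ∘ map g)
    ≡⟨ cong (_+ ∑ₗ (sublists xs) (h ∘ map g)) (sym (∑ₗ-map (x ∷_) (sublists xs) (h ∘ map g))) ⟩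
  ∑ₗ (map (x ∷_) (sublists xs)) (h ∘ map g) + ∑ₗ (sublists xs) (h ∘ map g)
    ≡⟨ sym (∑ₗ-++ (map (x ∷_) (sublists xs)) (sublists xs) (h ∘ map g)) ⟩
  ∑ₗ (sublists (x ∷ xs)) (h ∘ map g)
    ∎
  where open ≡-Reasoning

∑-sublists-only-[] : (xs : List X) (F : List X → ℕ) → (∀ c cs → F (c ∷ cs) ≡ 0) → ∑ₗ (sublists xs) F ≡ F []
∑-sublists-only-[] []       F F≡0 = +-identityʳ _
∑-sublists-only-[] (x ∷ xs) F F≡0 = begin
  ∑ₗ (map (x ∷_) (sublists xs) ++ sublists xs) F
    ≡⟨ ∑ₗ-++ (map (x ∷_) (sublists xs)) (sublists xs) F ⟩
  ∑ₗ (map (x ∷_) (sublists xs)) F + ∑ₗ (sublists xs) F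
    ≡⟨ cong₂ _+_ (trans (∑ₗ-map (x ∷_) (sublists xs) F) (∑ₗ-zero (sublists xs) _ (F≡0 x))) (∑-sublists-only-[] xs F F≡0) ⟩
  F []
    ∎
  where open ≡-Reasoning

∑-sublists-only-singletons : (xs : List X) (F : List X → ℕ) → F [] ≡ 0 → (∀ c c′ cs → F (c ∷ c′ ∷ cs) ≡ 0) →
  ∑ₗ (sublists xs) F ≡ ∑[ c ← xs ] F [ c ]
∑-sublists-only-singletons []       F F[]≡0 F≡0 = trans (+-identityʳ _) F[]≡0
∑-sublists-only-singletons (x ∷ xs) F F[]≡0 F≡0 = begin
  ∑ₗ (map (x ∷_) (sublists xs) ++ sublists xs) F
    ≡⟨ ∑ₗ-++ (map (x ∷_) (sublists xs)) (sublists xs) F ⟩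
  ∑ₗ (map (x ∷_) (sublists xs)) F + ∑ₗ (sublists xs) F
    ≡⟨ cong₂ _+_ (trans (∑ₗ-map (x ∷_) (sublists xs) F) (∑-sublists-only-[] xs (F ∘ (x ∷_)) (F≡0 x)))
                 (∑-sublists-only-singletons xs F F[]≡0 F≡0) ⟩
  F [ x ] + ∑[ c ← xs ] F [ c ]
    ∎
  where open ≡-Reasoning

∧-true⁻ˡ : ∀ {a b} → a ∧ b ≡ true → a ≡ true
∧-true⁻ˡ {true} _ = refl

∧-true⁻ʳ : ∀ {a b} → a ∧ b ≡ true → b ≡ true
∧-true⁻ʳ {true} b≡true = b≡true

∧-true⁺ : ∀ {a b} → a ≡ true → b ≡ true → a ∧ b ≡ true
∧-true⁺ refl refl = refl

infixl 7 _∖_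
infix 4 _⊆ᵇ_

_∖_ : ∀ {n} → Vec Bool n → Vec Bool n → Vec Bool n
[]      ∖ []       = []
(u ∷ U) ∖ (c ∷ cs) = (u ∧ not c) ∷ (U ∖ cs)

_⊆ᵇ_ : ∀ {n} → Vec Bool n → Vec Bool n → Bool
[]       ⊆ᵇ []      = true
(c ∷ cs) ⊆ᵇ (u ∷ U) = (not c ∨ u) ∧ (cs ⊆ᵇ U)

isEmptyᵇ : ∀ {n} → Vec Bool n → Bool
isEmptyᵇ []       = true
isEmptyᵇ (c ∷ cs) = not c ∧ isEmptyᵇ cs

-- Defined by tabulate, like Defs.singleton, so that singleton (suc N) 0 ≡ true ∷ ∅ holds by refl.
∅ : ∀ {n} → Subset n
∅ = tabulate (λ _ → false)

lookup-∖ : ∀ {n} (U c : Vec Bool n) i → lookup (U ∖ c) i ≡ lookup U i ∧ not (lookup c i)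
lookup-∖ (u ∷ U) (c ∷ cs) zero    = refl
lookup-∖ (u ∷ U) (c ∷ cs) (suc i) = lookup-∖ U cs i

lookup-∖⁻ : ∀ {n} (U c : Vec Bool n) i → lookup (U ∖ c) i ≡ true → lookup U i ≡ true × lookup c i ≡ false
lookup-∖⁻ U c i i∈U∖c with lookup U i | lookup c i | lookup-∖ U c i
... | true  | false | _  = refl , refl
... | true  | true  | eq = ⊥-elim (false≢true (trans (sym eq) i∈U∖c))
... | false | _     | eq = ⊥-elim (false≢true (trans (sym eq) i∈U∖c))

lookup-∖⁺ : ∀ {n} (U c : Vec Bool n) i → lookup U i ≡ true → lookup c i ≡ false → lookup (U ∖ c) i ≡ true
lookup-∖⁺ U c i i∈U i∉c = trans (lookup-∖ U c i) (cong₂ (λ a b → a ∧ not b) i∈U i∉c)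

⊆ᵇ⇒⊆ : ∀ {n} (c U : Vec Bool n) → (c ⊆ᵇ U) ≡ true → ∀ i → lookup c i ≡ true → lookup U i ≡ true
⊆ᵇ⇒⊆ (true  ∷ cs) (true  ∷ U) _   zero    _   = refl
⊆ᵇ⇒⊆ (false ∷ cs) (u     ∷ U) _   zero    ()
⊆ᵇ⇒⊆ (true  ∷ cs) (false ∷ U) ()  zero    _
⊆ᵇ⇒⊆ (x     ∷ cs) (u     ∷ U) c⊆U (suc i) i∈c = ⊆ᵇ⇒⊆ cs U (∧-true⁻ʳ {not x ∨ u} c⊆U) i i∈c

⊆⇒⊆ᵇ : ∀ {n} (c U : Vec Bool n) → (∀ i → lookup c i ≡ true → lookup U i ≡ true) → (c ⊆ᵇ U) ≡ true
⊆⇒⊆ᵇ []           []      _   = refl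
⊆⇒⊆ᵇ (true  ∷ cs) (u ∷ U) c⊆U = ∧-true⁺ (c⊆U zero refl) (⊆⇒⊆ᵇ cs U (c⊆U ∘ suc))
⊆⇒⊆ᵇ (false ∷ cs) (u ∷ U) c⊆U = ⊆⇒⊆ᵇ cs U (c⊆U ∘ suc)

isEmptyᵇ⇒≡∅ : ∀ {n} (c : Vec Bool n) → isEmptyᵇ c ≡ true → c ≡ ∅
isEmptyᵇ⇒≡∅ []           _        = refl
isEmptyᵇ⇒≡∅ (false ∷ cs) cs-empty = cong (false ∷_) (isEmptyᵇ⇒≡∅ cs cs-empty)
isEmptyᵇ⇒≡∅ (true  ∷ cs) ()

isEmptyᵇ-∅ : ∀ {n} → isEmptyᵇ (∅ {n}) ≡ true
isEmptyᵇ-∅ {zero}  = refl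
isEmptyᵇ-∅ {suc n} = isEmptyᵇ-∅ {n}

lookup-singleton : ∀ {N} (i : Fin N) → lookup (singleton N (toℕ i)) i ≡ true
lookup-singleton {suc N} zero    = refl
lookup-singleton {suc N} (suc i) = lookup-singleton i

-- Constrained partitions

-- What a constrained partition may say about an element i: whether {i} is a block is
-- free, forbidden or required.  Constraints φ : ℕ → Constraint are indexed by toℕ i.
data Constraint : Set where
  free forbidden required : Constraint

Satisfies : Constraint → Set → Set
Satisfies free      _ = ⊤
Satisfies forbidden H = ¬ H
Satisfies required  H = H

satisfies? : ∀ ℓ {H : Set} → Dec H → Dec (Satisfies ℓ H)
satisfies? free      _  = yes tt
satisfies? forbidden H? = ¬? H?
satisfies? required  H? = H?

Satisfies-map : ∀ ℓ {H H′ : Set} → (H → H′) → (H′ → H) → Satisfies ℓ H → Satisfies ℓ H′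
Satisfies-map free      _    _    _ = tt
Satisfies-map forbidden _    H′→H ¬H = ¬H ∘ H′→H
Satisfies-map required  H→H′ _    H = H→H′ H

Satisfies-¬required : ∀ ℓ {H : Set} → ℓ ≢ required → ¬ H → Satisfies ℓ H
Satisfies-¬required free      _ _  = tt
Satisfies-¬required forbidden _ ¬H = ¬H
Satisfies-¬required required  ℓ≢required _ = ⊥-elim (ℓ≢required refl)

Satisfies-required : ∀ {ℓ} {H : Set} → ℓ ≡ required → Satisfies ℓ H → H
Satisfies-required refl H = H

Covered : ∀ {N} → Fin N → List (Subset N) → Set
Covered i bs = Any (λ b → lookup b i ≡ true) bs

covered? : ∀ {N} (i : Fin N) bs → Dec (Covered i bs)
covered? i bs = any? (λ b → lookup b i ≟ᵇ true) bs

Covers : (N : ℕ) → Subset N → List (Subset N) → Set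
Covers N U bs = (i : Fin N) → (lookup U i ≡ true → Covered i bs) × (Covered i bs → lookup U i ≡ true)

Respects : (N : ℕ) → Subset N → (ℕ → Constraint) → List (Subset N) → Set
Respects N U φ bs = (i : Fin N) → lookup U i ≡ true → Satisfies (φ (toℕ i)) (HasSingleton N (toℕ i) bs)

ConstrainedPartition : (N : ℕ) → Subset N → (ℕ → Constraint) → List (Subset N) → Set
ConstrainedPartition N U φ bs = All Nonempty bs × AllPairs Disjoint bs × Covers N U bs × Respects N U φ bs

constrainedPartition? : (N : ℕ) (U : Subset N) (φ : ℕ → Constraint) (bs : List (Subset N)) →
                        Dec (ConstrainedPartition N U φ bs)
constrainedPartition? N U φ bs =
  all? nonempty? bs ×-dec allPairs? disjoint? bs
    ×-dec allFin? (λ i → ((lookup U i ≟ᵇ true) →-dec covered? i bs) ×-dec (covered? i bs →-dec (lookup U i ≟ᵇ true)))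
    ×-dec allFin? (λ i → (lookup U i ≟ᵇ true) →-dec satisfies? (φ (toℕ i)) (hasSingleton? N (toℕ i) bs))

#constrained : (N : ℕ) → Subset N → (ℕ → Constraint) → ℕ
#constrained N U φ = ∑[ bs ← sublists (allSubsets N) ] χ? (constrainedPartition? N U φ bs)

notRequired : Constraint → Bool
notRequired free      = true
notRequired forbidden = true
notRequired required  = false

noneRequiredᵇ : ∀ {n} → Vec Bool n → (ℕ → Constraint) → Bool
noneRequiredᵇ []       φ = true
noneRequiredᵇ (c ∷ cs) φ = (not c ∨ notRequired (φ 0)) ∧ noneRequiredᵇ cs (φ ∘ suc)

noneRequiredᵇ⇒ : ∀ {n} (c : Vec Bool n) φ → noneRequiredᵇ c φ ≡ true → ∀ i → lookup c i ≡ true → φ (toℕ i) ≢ required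
noneRequiredᵇ⇒ (true ∷ cs) φ none zero    _   φ0≡required with φ 0
noneRequiredᵇ⇒ (true ∷ cs) φ ()   zero    _   refl | required
noneRequiredᵇ⇒ (x    ∷ cs) φ none (suc i) i∈c =
  noneRequiredᵇ⇒ cs (φ ∘ suc) (∧-true⁻ʳ {not x ∨ notRequired (φ 0)} none) i i∈c

⇒noneRequiredᵇ : ∀ {n} (c : Vec Bool n) φ → (∀ i → lookup c i ≡ true → φ (toℕ i) ≢ required) → noneRequiredᵇ c φ ≡ true
⇒noneRequiredᵇ []           φ none = refl
⇒noneRequiredᵇ (true  ∷ cs) φ none = ∧-true⁺ (notRequired-≢ (φ 0) (none zero refl)) (⇒noneRequiredᵇ cs (φ ∘ suc) (none ∘ suc))
  where notRequired-≢ : ∀ ℓ → ℓ ≢ required → notRequired ℓ ≡ true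
        notRequired-≢ free      _ = refl
        notRequired-≢ forbidden _ = refl
        notRequired-≢ required  ℓ≢required = ⊥-elim (ℓ≢required refl)
⇒noneRequiredᵇ (false ∷ cs) φ none = ⇒noneRequiredᵇ cs (φ ∘ suc) (none ∘ suc)

-- Whether the block {0} ∪ c meets the constraint ℓ of its least element 0.
blockSatisfiesᵇ : ∀ {n} → Constraint → Vec Bool n → Bool
blockSatisfiesᵇ free      c = true
blockSatisfiesᵇ forbidden c = not (isEmptyᵇ c)
blockSatisfiesᵇ required  c = isEmptyᵇ c

blockSatisfiesᵇ⁺ : ∀ {N} ℓ (c : Subset N) {H : Set} → (H → c ≡ ∅) → (c ≡ ∅ → H) → Satisfies ℓ H → blockSatisfiesᵇ ℓ c ≡ true
blockSatisfiesᵇ⁺ free      c H→∅ ∅→H _ = refl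
blockSatisfiesᵇ⁺ forbidden c H→∅ ∅→H ¬H with isEmptyᵇ c in c-empty
... | false = refl
... | true  = ⊥-elim (¬H (∅→H (isEmptyᵇ⇒≡∅ c c-empty)))
blockSatisfiesᵇ⁺ {N} required  c H→∅ ∅→H H = subst (λ z → isEmptyᵇ z ≡ true) (sym (H→∅ H)) (isEmptyᵇ-∅ {N})

blockSatisfiesᵇ⁻ : ∀ {N} ℓ (c : Subset N) {H : Set} → (H → c ≡ ∅) → (c ≡ ∅ → H) → blockSatisfiesᵇ ℓ c ≡ true → Satisfies ℓ H
blockSatisfiesᵇ⁻ free      c H→∅ ∅→H _ = tt
blockSatisfiesᵇ⁻ {N} forbidden c H→∅ ∅→H nonempty H with isEmptyᵇ c in c-empty
blockSatisfiesᵇ⁻ forbidden c H→∅ ∅→H () H | true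
... | false = false≢true (trans (sym c-empty) (subst (λ z → isEmptyᵇ z ≡ true) (sym (H→∅ H)) (isEmptyᵇ-∅ {N})))
blockSatisfiesᵇ⁻ required  c H→∅ ∅→H empty = ∅→H (isEmptyᵇ⇒≡∅ c empty)

-- c can be the rest of the block of 0 in a constrained partition of {0} ∪ U.
admissibleᵇ : ∀ {n} → Constraint → (ℕ → Constraint) → Vec Bool n → Vec Bool n → Bool
admissibleᵇ ℓ φ U c = (c ⊆ᵇ U) ∧ (blockSatisfiesᵇ ℓ c ∧ noneRequiredᵇ c φ)

#partitions : (N : ℕ) → Subset N → (ℕ → Constraint) → ℕ
#partitions zero    []          φ = 1
#partitions (suc N) (false ∷ U) φ = #partitions N U (φ ∘ suc)
#partitions (suc N) (true  ∷ U) φ = ∑[ c ← allSubsets N ] (χ (admissibleᵇ (φ 0) (φ ∘ suc) U c) * #partitions N (U ∖ c) (φ ∘ suc))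

HasSingleton⇒Covered : ∀ {N} (i : Fin N) (bs : List (Subset N)) → HasSingleton N (toℕ i) bs → Covered i bs
HasSingleton⇒Covered i (b ∷ bs) (here refl) = here (lookup-singleton i)
HasSingleton⇒Covered i (b ∷ bs) (there p)   = there (HasSingleton⇒Covered i bs p)

module _ {N : ℕ} where

  lift : Subset N → Subset (suc N)
  lift = false ∷_

  withZero : Subset N → Subset (suc N)
  withZero = true ∷_

  Disjoint-lift⁺ : ∀ {b b′ : Subset N} → Disjoint b b′ → Disjoint (lift b) (lift b′)
  Disjoint-lift⁺ disjoint zero    (() , _)
  Disjoint-lift⁺ disjoint (suc i) both = disjoint i both

  All-Nonempty-lift⁺ : (bs : List (Subset N)) → All Nonempty bs → All Nonempty (map lift bs)
  All-Nonempty-lift⁺ bs = map⁺ ∘ All.map (λ (i , i∈b) → suc i , i∈b)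

  All-Nonempty-lift⁻ : (bs : List (Subset N)) → All Nonempty (map lift bs) → All Nonempty bs
  All-Nonempty-lift⁻ bs = All.map (λ { (suc i , i∈b) → i , i∈b }) ∘ map⁻

  AllPairs-Disjoint-lift⁺ : (bs : List (Subset N)) → AllPairs Disjoint bs → AllPairs Disjoint (map lift bs)
  AllPairs-Disjoint-lift⁺ bs = AllPairs-map⁺ ∘ AllPairs.map Disjoint-lift⁺

  AllPairs-Disjoint-lift⁻ : (bs : List (Subset N)) → AllPairs Disjoint (map lift bs) → AllPairs Disjoint bs
  AllPairs-Disjoint-lift⁻ bs = AllPairs.map (_∘ suc) ∘ AllPairs-map⁻

  Covered-lift⁺ : ∀ {i} (bs : List (Subset N)) → Covered i bs → Covered (suc i) (map lift bs)
  Covered-lift⁺ (b ∷ bs) (here p)  = here p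
  Covered-lift⁺ (b ∷ bs) (there p) = there (Covered-lift⁺ bs p)

  Covered-lift⁻ : ∀ {i} (bs : List (Subset N)) → Covered (suc i) (map lift bs) → Covered i bs
  Covered-lift⁻ (b ∷ bs) (here p)  = here p
  Covered-lift⁻ (b ∷ bs) (there p) = there (Covered-lift⁻ bs p)

  ¬Covered-zero-lift : (bs : List (Subset N)) → ¬ Covered zero (map lift bs)
  ¬Covered-zero-lift (b ∷ bs) (there p) = ¬Covered-zero-lift bs p

  HasSingleton-lift⁺ : ∀ j (bs : List (Subset N)) → HasSingleton N j bs → HasSingleton (suc N) (suc j) (map lift bs)
  HasSingleton-lift⁺ j (b ∷ bs) (here p)  = here (cong lift p)
  HasSingleton-lift⁺ j (b ∷ bs) (there p) = there (HasSingleton-lift⁺ j bs p)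

  HasSingleton-lift⁻ : ∀ j (bs : List (Subset N)) → HasSingleton (suc N) (suc j) (map lift bs) → HasSingleton N j bs
  HasSingleton-lift⁻ j (b ∷ bs) (here refl) = here refl
  HasSingleton-lift⁻ j (b ∷ bs) (there p)   = there (HasSingleton-lift⁻ j bs p)

  ¬HasSingleton-zero-lift : (bs : List (Subset N)) → ¬ HasSingleton (suc N) 0 (map lift bs)
  ¬HasSingleton-zero-lift (b ∷ bs) (there p) = ¬HasSingleton-zero-lift bs p

  HasSingleton-suc-withZero⁻ : ∀ j c (bs : List (Subset N)) →
    HasSingleton (suc N) (suc j) (withZero c ∷ map lift bs) → HasSingleton N j bs
  HasSingleton-suc-withZero⁻ j c bs (there p) = HasSingleton-lift⁻ j bs p

  HasSingleton-zero-withZero : ∀ c (bs : List (Subset N)) →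
    HasSingleton (suc N) 0 (withZero c ∷ map lift bs) → c ≡ ∅
  HasSingleton-zero-withZero c bs (here refl) = refl
  HasSingleton-zero-withZero c bs (there p)   = ⊥-elim (¬HasSingleton-zero-lift bs p)

All-blocks-⊆ : ∀ {N} (bs : List (Subset N)) {Q : Fin N → Set} → (∀ i → Covered i bs → Q i) →
  All (λ b → ∀ i → lookup b i ≡ true → Q i) bs
All-blocks-⊆ []       covered⇒Q = []
All-blocks-⊆ (b ∷ bs) covered⇒Q = (λ i i∈b → covered⇒Q i (here i∈b)) ∷ All-blocks-⊆ bs (λ i → covered⇒Q i ∘ there)

module _ {N : ℕ} (U : Subset N) (φ : ℕ → Constraint) (c : Subset N) (bs : List (Subset N)) where

  private
    blocks : List (Subset (suc N))
    blocks = withZero c ∷ map lift bs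

    singleton-zero⇒∅ : HasSingleton (suc N) 0 blocks → c ≡ ∅
    singleton-zero⇒∅ = HasSingleton-zero-withZero c bs

    ∅⇒singleton-zero : c ≡ ∅ → HasSingleton (suc N) 0 blocks
    ∅⇒singleton-zero refl = here refl

  ConstrainedPartition-withZero⁻ : ConstrainedPartition (suc N) (true ∷ U) φ blocks →
    admissibleᵇ (φ 0) (φ ∘ suc) U c ≡ true × ConstrainedPartition N (U ∖ c) (φ ∘ suc) bs
  ConstrainedPartition-withZero⁻ (_ ∷ nonempty , c-disjoint ∷ disjoint , covers , respects) =
    admissible , (All-Nonempty-lift⁻ bs nonempty , AllPairs-Disjoint-lift⁻ bs disjoint , covers′ , respects′)
    where
    c⊆U : ∀ i → lookup c i ≡ true → lookup U i ≡ true
    c⊆U i i∈c = proj₂ (covers (suc i)) (here i∈c)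
    ¬Covered-c : ∀ i → lookup c i ≡ true → ¬ Covered i bs
    ¬Covered-c i i∈c = All¬⇒¬Any (All.map (λ disjoint i∈b → disjoint (suc i) (i∈c , i∈b)) c-disjoint) ∘ Covered-lift⁺ bs
    ∉c : ∀ i → Covered i bs → lookup c i ≡ false
    ∉c i i∈bs with lookup c i in i∈c
    ... | false = refl
    ... | true  = ⊥-elim (¬Covered-c i i∈c i∈bs)
    covers′ : Covers N (U ∖ c) bs
    covers′ i = to , from
      where
      to : lookup (U ∖ c) i ≡ true → Covered i bs
      to i∈U∖c with lookup-∖⁻ U c i i∈U∖c
      ... | i∈U , i∉c with proj₁ (covers (suc i)) i∈U
      ...   | here i∈c    = ⊥-elim (false≢true (trans (sym i∉c) i∈c))
      ...   | there i∈bs  = Covered-lift⁻ bs i∈bs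
      from : Covered i bs → lookup (U ∖ c) i ≡ true
      from i∈bs = lookup-∖⁺ U c i (proj₂ (covers (suc i)) (there (Covered-lift⁺ bs i∈bs))) (∉c i i∈bs)
    respects′ : Respects N (U ∖ c) (φ ∘ suc) bs
    respects′ i i∈U∖c = Satisfies-map (φ (suc (toℕ i))) (HasSingleton-suc-withZero⁻ (toℕ i) c bs)
      (there ∘ HasSingleton-lift⁺ (toℕ i) bs) (respects (suc i) (proj₁ (lookup-∖⁻ U c i i∈U∖c)))
    noneRequired : ∀ i → lookup c i ≡ true → φ (suc (toℕ i)) ≢ required
    noneRequired i i∈c φi≡required = ¬Covered-c i i∈c (HasSingleton⇒Covered i bs
      (HasSingleton-suc-withZero⁻ (toℕ i) c bs (Satisfies-required φi≡required (respects (suc i) (c⊆U i i∈c)))))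
    admissible : admissibleᵇ (φ 0) (φ ∘ suc) U c ≡ true
    admissible = ∧-true⁺ (⊆⇒⊆ᵇ c U c⊆U)
      (∧-true⁺ (blockSatisfiesᵇ⁺ (φ 0) c singleton-zero⇒∅ ∅⇒singleton-zero (respects zero refl)) (⇒noneRequiredᵇ c (φ ∘ suc) noneRequired))

  ConstrainedPartition-withZero⁺ : admissibleᵇ (φ 0) (φ ∘ suc) U c ≡ true → ConstrainedPartition N (U ∖ c) (φ ∘ suc) bs →
    ConstrainedPartition (suc N) (true ∷ U) φ blocks
  ConstrainedPartition-withZero⁺ admissible (nonempty , disjoint , covers , respects) =
    ((zero , refl) ∷ All-Nonempty-lift⁺ bs nonempty) , (c-disjoint ∷ AllPairs-Disjoint-lift⁺ bs disjoint) , covers′ , respects′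
    where
    c⊆U : (c ⊆ᵇ U) ≡ true
    c⊆U = ∧-true⁻ˡ admissible
    block-ok : blockSatisfiesᵇ (φ 0) c ≡ true
    block-ok = ∧-true⁻ˡ (∧-true⁻ʳ {c ⊆ᵇ U} admissible)
    noneRequired : noneRequiredᵇ c (φ ∘ suc) ≡ true
    noneRequired = ∧-true⁻ʳ (∧-true⁻ʳ {c ⊆ᵇ U} admissible)
    bs⊆U∖c : ∀ i → Covered i bs → lookup (U ∖ c) i ≡ true
    bs⊆U∖c i = proj₂ (covers i)
    c-disjoint : All (Disjoint (withZero c)) (map lift bs)
    c-disjoint = map⁺ (All.map disjoint-lift (All-blocks-⊆ bs bs⊆U∖c))
      where
      disjoint-lift : ∀ {b} → (∀ i → lookup b i ≡ true → lookup (U ∖ c) i ≡ true) → Disjoint (withZero c) (lift b)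
      disjoint-lift b⊆U∖c zero    (_ , ())
      disjoint-lift b⊆U∖c (suc i) (i∈c , i∈b) = false≢true (trans (sym (proj₂ (lookup-∖⁻ U c i (b⊆U∖c i i∈b)))) i∈c)
    covers′ : Covers (suc N) (true ∷ U) blocks
    covers′ zero    = (λ _ → here refl) , (λ _ → refl)
    covers′ (suc i) = to , from
      where
      to : lookup U i ≡ true → Covered (suc i) blocks
      to i∈U with lookup c i in i∈c
      ... | true  = here i∈c
      ... | false = there (Covered-lift⁺ bs (proj₁ (covers i) (lookup-∖⁺ U c i i∈U i∈c)))
      from : Covered (suc i) blocks → lookup U i ≡ true
      from (here i∈c)   = ⊆ᵇ⇒⊆ c U c⊆U i i∈c
      from (there i∈bs) = proj₁ (lookup-∖⁻ U c i (bs⊆U∖c i (Covered-lift⁻ bs i∈bs)))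
    respects′ : Respects (suc N) (true ∷ U) φ blocks
    respects′ zero    _ = blockSatisfiesᵇ⁻ (φ 0) c singleton-zero⇒∅ ∅⇒singleton-zero block-ok
    respects′ (suc i) i∈U with lookup c i in i∈c
    ... | true  = Satisfies-¬required (φ (suc (toℕ i))) (noneRequiredᵇ⇒ c (φ ∘ suc) noneRequired i i∈c) ¬singleton
      where
      ¬singleton : ¬ HasSingleton (suc N) (suc (toℕ i)) blocks
      ¬singleton singleton = false≢true (trans (sym (proj₂ (lookup-∖⁻ U c i
        (bs⊆U∖c i (HasSingleton⇒Covered i bs (HasSingleton-suc-withZero⁻ (toℕ i) c bs singleton)))))) i∈c)
    ... | false = Satisfies-map (φ (suc (toℕ i))) (there ∘ HasSingleton-lift⁺ (toℕ i) bs)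
                    (HasSingleton-suc-withZero⁻ (toℕ i) c bs) (respects i (lookup-∖⁺ U c i i∈U i∈c))

module _ {N : ℕ} (U : Subset N) (φ : ℕ → Constraint) (bs : List (Subset N)) where

  ConstrainedPartition-lift⁻ : ConstrainedPartition (suc N) (false ∷ U) φ (map lift bs) → ConstrainedPartition N U (φ ∘ suc) bs
  ConstrainedPartition-lift⁻ (nonempty , disjoint , covers , respects) =
    All-Nonempty-lift⁻ bs nonempty , AllPairs-Disjoint-lift⁻ bs disjoint ,
    (λ i → Covered-lift⁻ bs ∘ proj₁ (covers (suc i)) , proj₂ (covers (suc i)) ∘ Covered-lift⁺ bs) ,
    (λ i i∈U → Satisfies-map (φ (suc (toℕ i))) (HasSingleton-lift⁻ (toℕ i) bs) (HasSingleton-lift⁺ (toℕ i) bs) (respects (suc i) i∈U))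

  ConstrainedPartition-lift⁺ : ConstrainedPartition N U (φ ∘ suc) bs → ConstrainedPartition (suc N) (false ∷ U) φ (map lift bs)
  ConstrainedPartition-lift⁺ (nonempty , disjoint , covers , respects) =
    All-Nonempty-lift⁺ bs nonempty , AllPairs-Disjoint-lift⁺ bs disjoint , covers′ , respects′
    where
    covers′ : Covers (suc N) (false ∷ U) (map lift bs)
    covers′ zero    = (λ ()) , (λ 0∈bs → ⊥-elim (¬Covered-zero-lift bs 0∈bs))
    covers′ (suc i) = Covered-lift⁺ bs ∘ proj₁ (covers i) , proj₂ (covers i) ∘ Covered-lift⁻ bs
    respects′ : Respects (suc N) (false ∷ U) φ (map lift bs)
    respects′ (suc i) i∈U =
      Satisfies-map (φ (suc (toℕ i))) (HasSingleton-lift⁺ (toℕ i) bs) (HasSingleton-lift⁻ (toℕ i) bs) (respects i i∈U)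

¬ConstrainedPartition-zero-uncovered : ∀ {N} (U : Subset N) φ (bs : List (Subset N)) →
  ¬ ConstrainedPartition (suc N) (true ∷ U) φ (map lift bs)
¬ConstrainedPartition-zero-uncovered U φ bs (_ , _ , covers , _) = ¬Covered-zero-lift bs (proj₁ (covers zero) refl)

¬ConstrainedPartition-zero-twice : ∀ {N} (U : Subset N) φ c c′ (bs : List (Subset (suc N))) →
  ¬ ConstrainedPartition (suc N) (true ∷ U) φ (withZero c ∷ withZero c′ ∷ bs)
¬ConstrainedPartition-zero-twice U φ c c′ bs (_ , ((disjoint ∷ _) ∷ _) , _ , _) = disjoint zero (refl , refl)

¬ConstrainedPartition-zero-outside : ∀ {N} (U : Subset N) φ c (bs : List (Subset (suc N))) →
  ¬ ConstrainedPartition (suc N) (false ∷ U) φ (withZero c ∷ bs)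
¬ConstrainedPartition-zero-outside U φ c bs (_ , _ , covers , _) = false≢true (proj₂ (covers zero) (here refl))

∑-sublists-allSubsets-suc : ∀ N (h : List (Subset (suc N)) → ℕ) →
  ∑ₗ (sublists (allSubsets (suc N))) h ≡ ∑[ as ← sublists (allSubsets N) ] ∑[ bs ← sublists (allSubsets N) ] h (map withZero as ++ map lift bs)
∑-sublists-allSubsets-suc N h = begin
  ∑ₗ (sublists (map withZero S ++ map lift S)) h
    ≡⟨ ∑-sublists-++ (map withZero S) (map lift S) h ⟩
  ∑[ as ← sublists (map withZero S) ] ∑[ bs ← sublists (map lift S) ] h (as ++ bs)
    ≡⟨ ∑-sublists-map withZero S _ ⟩
  ∑[ as ← sublists S ] ∑[ bs ← sublists (map lift S) ] h (map withZero as ++ bs)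
    ≡⟨ ∑ₗ-cong (sublists S) (λ as → ∑-sublists-map lift S (λ bs → h (map withZero as ++ bs))) ⟩
  ∑[ as ← sublists S ] ∑[ bs ← sublists S ] h (map withZero as ++ map lift bs)
    ∎
  where
  open ≡-Reasoning
  S : List (Subset N)
  S = allSubsets N

-- The sublists of allSubsets (suc N) are the concatenations of blocks containing 0 with blocks
-- avoiding 0; a constrained partition has exactly one block containing 0 if 0 ∈ U, and none if not.
#constrained≡#partitions : ∀ N U φ → #constrained N U φ ≡ #partitions N U φ
#constrained≡#partitions zero    []          φ =
  cong₂ _+_ (χ?-no (λ { ((() , _) ∷ _ , _) }) (constrainedPartition? 0 [] φ ([] ∷ [])))
            (trans (+-identityʳ _) (χ?-yes ([] , [] , (λ ()) , (λ ())) (constrainedPartition? 0 [] φ [])))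
#constrained≡#partitions (suc N) (false ∷ U) φ = begin
  #constrained (suc N) (false ∷ U) φ
    ≡⟨ ∑-sublists-allSubsets-suc N _ ⟩
  ∑[ as ← sublists S ] ∑[ bs ← sublists S ] count (map withZero as ++ map lift bs)
    ≡⟨ ∑-sublists-only-[] S _ (λ c cs → ∑ₗ-zero (sublists S) _ (λ bs → χ?-no
         (¬ConstrainedPartition-zero-outside U φ c (map withZero cs ++ map lift bs)) (constrainedPartition? (suc N) (false ∷ U) φ _))) ⟩
  ∑[ bs ← sublists S ] count (map lift bs)
    ≡⟨ ∑ₗ-cong (sublists S) (λ bs → χ?-cong (ConstrainedPartition-lift⁻ U φ bs) (ConstrainedPartition-lift⁺ U φ bs)
         (constrainedPartition? (suc N) (false ∷ U) φ (map lift bs)) (constrainedPartition? N U (φ ∘ suc) bs)) ⟩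
  #constrained N U (φ ∘ suc)
    ≡⟨ #constrained≡#partitions N U (φ ∘ suc) ⟩
  #partitions N U (φ ∘ suc)
    ∎
  where
  open ≡-Reasoning
  S : List (Subset N)
  S = allSubsets N
  count : List (Subset (suc N)) → ℕ
  count bs = χ? (constrainedPartition? (suc N) (false ∷ U) φ bs)
#constrained≡#partitions (suc N) (true ∷ U) φ = begin
  #constrained (suc N) (true ∷ U) φ
    ≡⟨ ∑-sublists-allSubsets-suc N _ ⟩
  ∑[ as ← sublists S ] ∑[ bs ← sublists S ] count (map withZero as ++ map lift bs)
    ≡⟨ ∑-sublists-only-singletons S _
         (∑ₗ-zero (sublists S) _ (λ bs → χ?-no (¬ConstrainedPartition-zero-uncovered U φ bs) (constrainedPartition? (suc N) (true ∷ U) φ _)))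
         (λ c c′ cs → ∑ₗ-zero (sublists S) _ (λ bs → χ?-no
           (¬ConstrainedPartition-zero-twice U φ c c′ (map withZero cs ++ map lift bs)) (constrainedPartition? (suc N) (true ∷ U) φ _))) ⟩
  ∑[ c ← S ] ∑[ bs ← sublists S ] count (withZero c ∷ map lift bs)
    ≡⟨ ∑ₗ-cong S (λ c → ∑ₗ-cong (sublists S) (λ bs → χ?-split (admissible c)
         (ConstrainedPartition-withZero⁻ U φ c bs) (ConstrainedPartition-withZero⁺ U φ c bs)
         (constrainedPartition? (suc N) (true ∷ U) φ _) (constrainedPartition? N (U ∖ c) (φ ∘ suc) bs))) ⟩
  ∑[ c ← S ] ∑[ bs ← sublists S ] (χ (admissible c) * χ? (constrainedPartition? N (U ∖ c) (φ ∘ suc) bs))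
    ≡⟨ ∑ₗ-cong S (λ c → trans (∑ₗ-distribˡ-* (sublists S) (χ (admissible c)) _)
         (cong (χ (admissible c) *_) (#constrained≡#partitions N (U ∖ c) (φ ∘ suc)))) ⟩
  #partitions (suc N) (true ∷ U) φ
    ∎
  where
  open ≡-Reasoning
  S : List (Subset N)
  S = allSubsets N
  count : List (Subset (suc N)) → ℕ
  count bs = χ? (constrainedPartition? (suc N) (true ∷ U) φ bs)
  admissible : Subset N → Bool
  admissible = admissibleᵇ (φ 0) (φ ∘ suc) U

noneRequiredᵇ-cong : ∀ {n} (c : Vec Bool n) φ ψ → (∀ x → x < n → φ x ≡ ψ x) → noneRequiredᵇ c φ ≡ noneRequiredᵇ c ψ
noneRequiredᵇ-cong []      φ ψ φ≡ψ = refl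
noneRequiredᵇ-cong (x ∷ c) φ ψ φ≡ψ = cong₂ (λ a b → (not x ∨ notRequired a) ∧ b) (φ≡ψ 0 (s≤s z≤n))
  (noneRequiredᵇ-cong c (φ ∘ suc) (ψ ∘ suc) (λ y y<n → φ≡ψ (suc y) (s≤s y<n)))

#partitions-cong : ∀ N U φ ψ → (∀ x → x < N → φ x ≡ ψ x) → #partitions N U φ ≡ #partitions N U ψ
#partitions-cong zero    []          φ ψ φ≡ψ = refl
#partitions-cong (suc N) (false ∷ U) φ ψ φ≡ψ = #partitions-cong N U (φ ∘ suc) (ψ ∘ suc) (λ y y<N → φ≡ψ (suc y) (s≤s y<N))
#partitions-cong (suc N) (true  ∷ U) φ ψ φ≡ψ = ∑ₗ-cong (allSubsets N) (λ c → cong₂ _*_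
  (cong χ (cong₂ (λ a b → (c ⊆ᵇ U) ∧ (blockSatisfiesᵇ a c ∧ b)) (φ≡ψ 0 (s≤s z≤n)) (noneRequiredᵇ-cong c (φ ∘ suc) (ψ ∘ suc) φ≡ψ∘suc)))
  (#partitions-cong N (U ∖ c) (φ ∘ suc) (ψ ∘ suc) φ≡ψ∘suc))
  where φ≡ψ∘suc : ∀ y → y < N → φ (suc y) ≡ ψ (suc y)
        φ≡ψ∘suc y y<N = φ≡ψ (suc y) (s≤s y<N)

⊆ᵇ-∉ : ∀ {n} (c V : Vec Bool n) i → lookup c i ≡ true → lookup V i ≡ false → (c ⊆ᵇ V) ≡ false
⊆ᵇ-∉ (true ∷ c) (false ∷ V) zero    _   _   = refl
⊆ᵇ-∉ (x    ∷ c) (v     ∷ V) (suc i) i∈c i∉V = trans (cong ((not x ∨ v) ∧_) (⊆ᵇ-∉ c V i i∈c i∉V)) (∧-zeroʳ _)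

noneRequiredᵇ-required : ∀ {n} (c : Vec Bool n) φ i → lookup c i ≡ true → φ (toℕ i) ≡ required → noneRequiredᵇ c φ ≡ false
noneRequiredᵇ-required (true ∷ c) φ zero    _   φ0≡required rewrite φ0≡required = refl
noneRequiredᵇ-required (x    ∷ c) φ (suc i) i∈c φi≡required =
  trans (cong ((not x ∨ notRequired (φ 0)) ∧_) (noneRequiredᵇ-required c (φ ∘ suc) i i∈c φi≡required)) (∧-zeroʳ _)

⊆ᵇ-[]≔false : ∀ {n} (c V : Vec Bool n) i → lookup c i ≡ false → (c ⊆ᵇ V [ i ]≔ false) ≡ (c ⊆ᵇ V)
⊆ᵇ-[]≔false (false ∷ c) (v ∷ V) zero    _   = refl
⊆ᵇ-[]≔false (x     ∷ c) (v ∷ V) (suc i) i∉c = cong ((not x ∨ v) ∧_) (⊆ᵇ-[]≔false c V i i∉c)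

[]≔false-∖ : ∀ {n} (V c : Vec Bool n) i → (V [ i ]≔ false) ∖ c ≡ (V ∖ c) [ i ]≔ false
[]≔false-∖ (v ∷ V) (x ∷ c) zero    = refl
[]≔false-∖ (v ∷ V) (x ∷ c) (suc i) = cong ((v ∧ not x) ∷_) ([]≔false-∖ V c i)

∅-⊆ᵇ : ∀ {n} (U : Vec Bool n) → (∅ ⊆ᵇ U) ≡ true
∅-⊆ᵇ []      = refl
∅-⊆ᵇ (u ∷ U) = ∅-⊆ᵇ U

noneRequiredᵇ-∅ : ∀ {n} φ → noneRequiredᵇ (∅ {n}) φ ≡ true
noneRequiredᵇ-∅ {zero}  φ = refl
noneRequiredᵇ-∅ {suc n} φ = noneRequiredᵇ-∅ {n} (φ ∘ suc)

∖-∅ : ∀ {n} (U : Vec Bool n) → U ∖ ∅ ≡ U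
∖-∅ []      = refl
∖-∅ (u ∷ U) = cong₂ _∷_ (∧-identityʳ u) (∖-∅ U)

∑-allSubsets-suc : ∀ N (F : Subset (suc N) → ℕ) →
  ∑ₗ (allSubsets (suc N)) F ≡ ∑[ c ← allSubsets N ] F (true ∷ c) + ∑[ c ← allSubsets N ] F (false ∷ c)
∑-allSubsets-suc N F = trans (∑ₗ-++ (map (true ∷_) (allSubsets N)) (map (false ∷_) (allSubsets N)) F)
                             (cong₂ _+_ (∑ₗ-map (true ∷_) (allSubsets N) F) (∑ₗ-map (false ∷_) (allSubsets N) F))

∑-isEmpty : ∀ N (f : Subset N → ℕ) → ∑[ c ← allSubsets N ] (χ (isEmptyᵇ c) * f c) ≡ f ∅
∑-isEmpty zero    f = trans (+-identityʳ (1 * f [])) (*-identityˡ (f []))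
∑-isEmpty (suc N) f = begin
  ∑[ c ← allSubsets (suc N) ] (χ (isEmptyᵇ c) * f c)
    ≡⟨ ∑-allSubsets-suc N _ ⟩
  ∑[ c ← allSubsets N ] 0 + ∑[ c ← allSubsets N ] (χ (isEmptyᵇ c) * f (false ∷ c))
    ≡⟨ cong₂ _+_ (∑ₗ-zero (allSubsets N) _ (λ _ → refl)) (∑-isEmpty N (f ∘ (false ∷_))) ⟩
  f ∅
    ∎
  where open ≡-Reasoning

-- The block of an element whose singleton is required is forced.
#partitions-remove-required : ∀ N (U : Subset N) (i : Fin N) φ → lookup U i ≡ true → φ (toℕ i) ≡ required →
  #partitions N U φ ≡ #partitions N (U [ i ]≔ false) φ
#partitions-remove-required (suc N) (true ∷ U) zero φ _ φ0≡required rewrite φ0≡required = begin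
  ∑[ c ← allSubsets N ] (χ (admissibleᵇ required (φ ∘ suc) U c) * #partitions N (U ∖ c) (φ ∘ suc))
    ≡⟨ ∑ₗ-cong (allSubsets N) only-∅ ⟩
  ∑[ c ← allSubsets N ] (χ (isEmptyᵇ c) * #partitions N (U ∖ c) (φ ∘ suc))
    ≡⟨ ∑-isEmpty N (λ c → #partitions N (U ∖ c) (φ ∘ suc)) ⟩
  #partitions N (U ∖ ∅) (φ ∘ suc)
    ≡⟨ cong (λ V → #partitions N V (φ ∘ suc)) (∖-∅ U) ⟩
  #partitions N U (φ ∘ suc)
    ∎
  where
  open ≡-Reasoning
  only-∅ : ∀ c → χ (admissibleᵇ required (φ ∘ suc) U c) * #partitions N (U ∖ c) (φ ∘ suc)
               ≡ χ (isEmptyᵇ c) * #partitions N (U ∖ c) (φ ∘ suc)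
  only-∅ c with isEmptyᵇ c in c-empty
  ... | false = cong (λ b → χ b * #partitions N (U ∖ c) (φ ∘ suc)) (∧-zeroʳ (c ⊆ᵇ U))
  ... | true rewrite isEmptyᵇ⇒≡∅ c c-empty | ∅-⊆ᵇ U | noneRequiredᵇ-∅ {N} (φ ∘ suc) = refl
#partitions-remove-required (suc N) (false ∷ U) (suc i) φ i∈U φi≡required =
  #partitions-remove-required N U i (φ ∘ suc) i∈U φi≡required
#partitions-remove-required (suc N) (true  ∷ U) (suc i) φ i∈U φi≡required = ∑ₗ-cong (allSubsets N) unaffected
  where
  unaffected : ∀ c → χ (admissibleᵇ (φ 0) (φ ∘ suc) U c) * #partitions N (U ∖ c) (φ ∘ suc)
                   ≡ χ (admissibleᵇ (φ 0) (φ ∘ suc) (U [ i ]≔ false) c) * #partitions N ((U [ i ]≔ false) ∖ c) (φ ∘ suc)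
  unaffected c with lookup c i in i∈c
  ... | true  = begin
    χ ((c ⊆ᵇ U) ∧ (blockSatisfiesᵇ (φ 0) c ∧ noneRequiredᵇ c (φ ∘ suc))) * #partitions N (U ∖ c) (φ ∘ suc)
      ≡⟨ cong (λ b → χ ((c ⊆ᵇ U) ∧ (blockSatisfiesᵇ (φ 0) c ∧ b)) * #partitions N (U ∖ c) (φ ∘ suc))
              (noneRequiredᵇ-required c (φ ∘ suc) i i∈c φi≡required) ⟩
    χ ((c ⊆ᵇ U) ∧ (blockSatisfiesᵇ (φ 0) c ∧ false)) * #partitions N (U ∖ c) (φ ∘ suc)
      ≡⟨ cong (λ b → χ ((c ⊆ᵇ U) ∧ b) * #partitions N (U ∖ c) (φ ∘ suc)) (∧-zeroʳ (blockSatisfiesᵇ (φ 0) c)) ⟩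
    χ ((c ⊆ᵇ U) ∧ false) * #partitions N (U ∖ c) (φ ∘ suc)
      ≡⟨ cong (λ b → χ b * #partitions N (U ∖ c) (φ ∘ suc)) (∧-zeroʳ (c ⊆ᵇ U)) ⟩
    0
      ≡⟨ cong (λ b → χ (b ∧ (blockSatisfiesᵇ (φ 0) c ∧ noneRequiredᵇ c (φ ∘ suc))) * #partitions N ((U [ i ]≔ false) ∖ c) (φ ∘ suc))
              (sym (⊆ᵇ-∉ c (U [ i ]≔ false) i i∈c (lookup∘update i U false))) ⟩
    χ ((c ⊆ᵇ U [ i ]≔ false) ∧ (blockSatisfiesᵇ (φ 0) c ∧ noneRequiredᵇ c (φ ∘ suc))) * #partitions N ((U [ i ]≔ false) ∖ c) (φ ∘ suc)
      ∎
    where open ≡-Reasoning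
  ... | false = cong₂ (λ a b → χ (a ∧ (blockSatisfiesᵇ (φ 0) c ∧ noneRequiredᵇ c (φ ∘ suc))) * b)
    (sym (⊆ᵇ-[]≔false c U i i∈c))
    (trans (#partitions-remove-required N (U ∖ c) i (φ ∘ suc) (lookup-∖⁺ U c i i∈U i∈c) φi≡required)
           (cong (λ V → #partitions N V (φ ∘ suc)) (sym ([]≔false-∖ U c i))))

punchInℕ : ℕ → ℕ → ℕ
punchInℕ zero    x       = suc x
punchInℕ (suc i) zero    = zero
punchInℕ (suc i) (suc x) = suc (punchInℕ i x)

⊆ᵇ-insertAt : ∀ {N} (i : Fin (suc N)) (d : Vec Bool N) U → (insertAt d i false ⊆ᵇ U) ≡ (d ⊆ᵇ removeAt U i)
⊆ᵇ-insertAt         zero    d       (u ∷ U)     = refl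
⊆ᵇ-insertAt {suc N} (suc i) (x ∷ d) (u ∷ u′ ∷ U) = cong ((not x ∨ u) ∧_) (⊆ᵇ-insertAt i d (u′ ∷ U))

isEmptyᵇ-insertAt : ∀ {N} (i : Fin (suc N)) (d : Vec Bool N) → isEmptyᵇ (insertAt d i false) ≡ isEmptyᵇ d
isEmptyᵇ-insertAt zero    d       = refl
isEmptyᵇ-insertAt (suc i) (x ∷ d) = cong (not x ∧_) (isEmptyᵇ-insertAt i d)

blockSatisfiesᵇ-insertAt : ∀ {N} ℓ (i : Fin (suc N)) (d : Vec Bool N) → blockSatisfiesᵇ ℓ (insertAt d i false) ≡ blockSatisfiesᵇ ℓ d
blockSatisfiesᵇ-insertAt free      i d = refl
blockSatisfiesᵇ-insertAt forbidden i d = cong not (isEmptyᵇ-insertAt i d)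
blockSatisfiesᵇ-insertAt required  i d = isEmptyᵇ-insertAt i d

noneRequiredᵇ-insertAt : ∀ {N} (i : Fin (suc N)) (d : Vec Bool N) φ →
  noneRequiredᵇ (insertAt d i false) φ ≡ noneRequiredᵇ d (φ ∘ punchInℕ (toℕ i))
noneRequiredᵇ-insertAt zero    d       φ = refl
noneRequiredᵇ-insertAt (suc i) (x ∷ d) φ = cong ((not x ∨ notRequired (φ 0)) ∧_) (noneRequiredᵇ-insertAt i d (φ ∘ suc))

removeAt-∖-insertAt : ∀ {N} (i : Fin (suc N)) (U : Vec Bool (suc N)) d → removeAt (U ∖ insertAt d i false) i ≡ removeAt U i ∖ d
removeAt-∖-insertAt         zero    (u ∷ U)      d       = refl
removeAt-∖-insertAt {suc N} (suc zero)    (u ∷ u′ ∷ U) (x ∷ d)      = refl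
removeAt-∖-insertAt {suc N} (suc (suc i)) (u ∷ u′ ∷ U) (x ∷ x′ ∷ d) =
  cong ((u ∧ not x) ∷_) (removeAt-∖-insertAt (suc i) (u′ ∷ U) (x′ ∷ d))

∑-allSubsets-insertAt : ∀ M (i : Fin (suc M)) (F : Subset (suc M) → ℕ) →
  ∑ₗ (allSubsets (suc M)) F ≡ ∑[ c ← allSubsets M ] F (insertAt c i true) + ∑[ c ← allSubsets M ] F (insertAt c i false)
∑-allSubsets-insertAt M       zero    F = ∑-allSubsets-suc M F
∑-allSubsets-insertAt (suc M) (suc i) F = begin
  ∑ₗ (allSubsets (suc (suc M))) F
    ≡⟨ ∑-allSubsets-suc (suc M) F ⟩
  ∑[ c ← allSubsets (suc M) ] F (true ∷ c) + ∑[ c ← allSubsets (suc M) ] F (false ∷ c)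
    ≡⟨ cong₂ _+_ (∑-allSubsets-insertAt M i (F ∘ (true ∷_))) (∑-allSubsets-insertAt M i (F ∘ (false ∷_))) ⟩
  (sum true true + sum true false) + (sum false true + sum false false)
    ≡⟨ +-interchange (sum true true) (sum true false) (sum false true) (sum false false) ⟩
  (sum true true + sum false true) + (sum true false + sum false false)
    ≡⟨ sym (cong₂ _+_ (∑-allSubsets-suc M (λ c → F (insertAt c (suc i) true))) (∑-allSubsets-suc M (λ c → F (insertAt c (suc i) false)))) ⟩
  ∑[ c ← allSubsets (suc M) ] F (insertAt c (suc i) true) + ∑[ c ← allSubsets (suc M) ] F (insertAt c (suc i) false)
    ∎
  where
  open ≡-Reasoning
  sum : Bool → Bool → ℕ
  sum x y = ∑[ c ← allSubsets M ] F (x ∷ insertAt c i y)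

#partitions-removeAt : ∀ N (U : Subset (suc N)) (i : Fin (suc N)) φ → lookup U i ≡ false →
  #partitions (suc N) U φ ≡ #partitions N (removeAt U i) (φ ∘ punchInℕ (toℕ i))
#partitions-removeAt N       (false ∷ U)      zero    φ _   = refl
#partitions-removeAt (suc N) (false ∷ u ∷ U)  (suc i) φ i∉U = #partitions-removeAt N (u ∷ U) i (φ ∘ suc) i∉U
#partitions-removeAt (suc N) (true  ∷ u ∷ U)  (suc i) φ i∉U = begin
  ∑ₗ (allSubsets (suc N)) F
    ≡⟨ ∑-allSubsets-insertAt N i F ⟩
  ∑[ c ← allSubsets N ] F (insertAt c i true) + ∑[ c ← allSubsets N ] F (insertAt c i false)
    ≡⟨ cong₂ _+_ (∑ₗ-zero (allSubsets N) _ containing-i) (∑ₗ-cong (allSubsets N) avoiding-i) ⟩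
  ∑[ d ← allSubsets N ] (χ (admissibleᵇ (φ 0) (ψ ∘ suc) (removeAt (u ∷ U) i) d) * #partitions N (removeAt (u ∷ U) i ∖ d) (ψ ∘ suc))
    ∎
  where
  open ≡-Reasoning
  ψ : ℕ → Constraint
  ψ = φ ∘ punchInℕ (toℕ (suc i))
  F : Subset (suc N) → ℕ
  F c = χ (admissibleᵇ (φ 0) (φ ∘ suc) (u ∷ U) c) * #partitions (suc N) ((u ∷ U) ∖ c) (φ ∘ suc)
  containing-i : ∀ d → F (insertAt d i true) ≡ 0
  containing-i d = cong (λ b → χ (b ∧ _) * #partitions (suc N) ((u ∷ U) ∖ insertAt d i true) (φ ∘ suc))
                        (⊆ᵇ-∉ (insertAt d i true) (u ∷ U) i (insertAt-lookup d i true) i∉U)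
  avoiding-i : ∀ d → F (insertAt d i false)
                   ≡ χ (admissibleᵇ (φ 0) (ψ ∘ suc) (removeAt (u ∷ U) i) d) * #partitions N (removeAt (u ∷ U) i ∖ d) (ψ ∘ suc)
  avoiding-i d = cong₂ _*_
    (cong χ (cong₂ _∧_ (⊆ᵇ-insertAt i d (u ∷ U)) (cong₂ _∧_ (blockSatisfiesᵇ-insertAt (φ 0) i d) (noneRequiredᵇ-insertAt i d (φ ∘ suc)))))
    (trans (#partitions-removeAt N ((u ∷ U) ∖ insertAt d i false) i (φ ∘ suc)
             (trans (lookup-∖ (u ∷ U) (insertAt d i false) i) (cong (_∧ not (lookup (insertAt d i false) i)) i∉U)))
           (cong (λ V → #partitions N V (ψ ∘ suc)) (removeAt-∖-insertAt i (u ∷ U) d)))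

size : ∀ {n} → Vec Bool n → ℕ
size []          = 0
size (true  ∷ U) = suc (size U)
size (false ∷ U) = size U

∑-⊆-binomial : ∀ N (U : Subset N) (f : ℕ → ℕ) →
  ∑[ c ← allSubsets N ] (χ (c ⊆ᵇ U) * f (size (U ∖ c))) ≡ ∑[ i < suc (size U) ] ((size U C i) * f i)
∑-⊆-binomial zero    []          f = +-identityʳ _
∑-⊆-binomial (suc N) (false ∷ U) f = begin
  ∑[ c ← allSubsets (suc N) ] (χ (c ⊆ᵇ false ∷ U) * f (size ((false ∷ U) ∖ c)))
    ≡⟨ ∑-allSubsets-suc N _ ⟩
  ∑[ c ← allSubsets N ] 0 + ∑[ c ← allSubsets N ] (χ (c ⊆ᵇ U) * f (size (U ∖ c)))
    ≡⟨ cong₂ _+_ (∑ₗ-zero (allSubsets N) _ (λ _ → refl)) (∑-⊆-binomial N U f) ⟩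
  ∑[ i < suc (size U) ] ((size U C i) * f i)
    ∎
  where open ≡-Reasoning
∑-⊆-binomial (suc N) (true  ∷ U) f = begin
  ∑[ c ← allSubsets (suc N) ] (χ (c ⊆ᵇ true ∷ U) * f (size ((true ∷ U) ∖ c)))
    ≡⟨ ∑-allSubsets-suc N _ ⟩
  ∑[ c ← allSubsets N ] (χ (c ⊆ᵇ U) * f (size (U ∖ c))) + ∑[ c ← allSubsets N ] (χ (c ⊆ᵇ U) * f (suc (size (U ∖ c))))
    ≡⟨ cong₂ _+_ (∑-⊆-binomial N U f) (∑-⊆-binomial N U (f ∘ suc)) ⟩
  ∑[ i < suc (size U) ] ((size U C i) * f i) + ∑[ i < suc (size U) ] ((size U C i) * f (suc i))
    ≡⟨ sym (∑-pascal (size U) f) ⟩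
  ∑[ i < suc (suc (size U)) ] ((suc (size U) C i) * f i)
    ∎
  where open ≡-Reasoning

#partitions-free≡bell : ∀ N (U : Subset N) → #partitions N U (λ _ → free) ≡ bell (size U)
#partitions-free≡bell zero    []          = refl
#partitions-free≡bell (suc N) (false ∷ U) = #partitions-free≡bell N U
#partitions-free≡bell (suc N) (true  ∷ U) = begin
  ∑[ c ← allSubsets N ] (χ ((c ⊆ᵇ U) ∧ (true ∧ noneRequiredᵇ c (λ _ → free))) * #partitions N (U ∖ c) (λ _ → free))
    ≡⟨ ∑ₗ-cong (allSubsets N) (λ c → cong₂ _*_ (cong (λ b → χ ((c ⊆ᵇ U) ∧ b)) (noneRequired-free c)) (#partitions-free≡bell N (U ∖ c))) ⟩
  ∑[ c ← allSubsets N ] (χ ((c ⊆ᵇ U) ∧ true) * bell (size (U ∖ c)))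
    ≡⟨ ∑ₗ-cong (allSubsets N) (λ c → cong (λ b → χ b * bell (size (U ∖ c))) (∧-identityʳ (c ⊆ᵇ U))) ⟩
  ∑[ c ← allSubsets N ] (χ (c ⊆ᵇ U) * bell (size (U ∖ c)))
    ≡⟨ ∑-⊆-binomial N U bell ⟩
  ∑[ i < suc (size U) ] ((size U C i) * bell i)
    ≡⟨ sym (bell-recurrence (size U)) ⟩
  bell (suc (size U))
    ∎
  where
  open ≡-Reasoning
  noneRequired-free : ∀ {n} (c : Vec Bool n) → noneRequiredᵇ c (λ _ → free) ≡ true
  noneRequired-free c = ⇒noneRequiredᵇ c (λ _ → free) (λ _ _ ())

-- Partitions without late singletons

threshold : ℕ → Constraint → ℕ → Constraint
threshold zero    X zero    = X
threshold zero    X (suc x) = forbidden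
threshold (suc k) X zero    = free
threshold (suc k) X (suc x) = threshold k X x

data ThresholdView (k : ℕ) (X : Constraint) (x : ℕ) : Set where
  below : x < k → threshold k X x ≡ free      → ThresholdView k X x
  at    : x ≡ k → threshold k X x ≡ X         → ThresholdView k X x
  above : k < x → threshold k X x ≡ forbidden → ThresholdView k X x

threshold-view : ∀ k X x → ThresholdView k X x
threshold-view zero    X zero    = at refl refl
threshold-view zero    X (suc x) = above (s≤s z≤n) refl
threshold-view (suc k) X zero    = below (s≤s z≤n) refl
threshold-view (suc k) X (suc x) with threshold-view k X x
... | below x<k eq = below (s≤s x<k) eq
... | at    x≡k eq = at (cong suc x≡k) eq
... | above k<x eq = above (s≤s k<x) eq

threshold-below : ∀ {k x} X → x < k → threshold k X x ≡ free
threshold-below {suc k} {zero}  X _         = refl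
threshold-below {suc k} {suc x} X (s≤s x<k) = threshold-below X x<k

threshold-at : ∀ k X → threshold k X k ≡ X
threshold-at zero    X = refl
threshold-at (suc k) X = threshold-at k X

threshold-free : ∀ k x → threshold k free x ≡ threshold (suc k) forbidden x
threshold-free zero    zero          = refl
threshold-free zero    (suc zero)    = refl
threshold-free zero    (suc (suc x)) = refl
threshold-free (suc k) zero          = refl
threshold-free (suc k) (suc x)       = threshold-free k x

threshold-punchIn : ∀ k x → threshold k required (punchInℕ k x) ≡ threshold k forbidden x
threshold-punchIn zero    zero    = refl
threshold-punchIn zero    (suc x) = refl
threshold-punchIn (suc k) zero    = refl
threshold-punchIn (suc k) (suc x) = threshold-punchIn k x

Satisfies-threshold-change : ∀ k X Y x {H : Set} → (x ≡ k → Satisfies X H → Satisfies Y H) →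
  Satisfies (threshold k X x) H → Satisfies (threshold k Y x) H
Satisfies-threshold-change k X Y x {H} X⇒Y sat with threshold-view k X x | threshold-view k Y x
... | below _ eq   | below _ eq′   = subst (λ ℓ → Satisfies ℓ H) (trans eq (sym eq′)) sat
... | at    x≡k eq | at    _ eq′   = subst (λ ℓ → Satisfies ℓ H) (sym eq′) (X⇒Y x≡k (subst (λ ℓ → Satisfies ℓ H) eq sat))
... | above _ eq   | above _ eq′   = subst (λ ℓ → Satisfies ℓ H) (trans eq (sym eq′)) sat
... | below x<k _  | at    x≡k _   = ⊥-elim (<-irrefl x≡k x<k)
... | below x<k _  | above k<x _   = ⊥-elim (<-asym x<k k<x)
... | at    x≡k _  | below x<k _   = ⊥-elim (<-irrefl x≡k x<k)
... | at    x≡k _  | above k<x _   = ⊥-elim (<-irrefl (sym x≡k) k<x)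
... | above k<x _  | below x<k _   = ⊥-elim (<-asym x<k k<x)
... | above k<x _  | at    x≡k _   = ⊥-elim (<-irrefl (sym x≡k) k<x)

Satisfies-threshold-at : ∀ {N} k X (i : Fin N) (bs : List (Subset N)) → toℕ i ≡ k →
  Satisfies (threshold k X (toℕ i)) (HasSingleton N (toℕ i) bs) → Satisfies X (HasSingleton N k bs)
Satisfies-threshold-at k X i bs refl sat = subst (λ ℓ → Satisfies ℓ _) (threshold-at k X) sat

ConstrainedPartition-weaken : ∀ {N} (U : Subset N) (bs : List (Subset N)) φ ψ →
  (∀ i → lookup U i ≡ true → Satisfies (φ (toℕ i)) (HasSingleton N (toℕ i) bs) → Satisfies (ψ (toℕ i)) (HasSingleton N (toℕ i) bs)) →
  ConstrainedPartition N U φ bs → ConstrainedPartition N U ψ bs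
ConstrainedPartition-weaken U bs φ ψ φ⇒ψ (nonempty , disjoint , covers , respects) =
  nonempty , disjoint , covers , (λ i i∈U → φ⇒ψ i i∈U (respects i i∈U))

#constrained-free-split : ∀ N k (U : Subset N) (i : Fin N) → toℕ i ≡ k → lookup U i ≡ true →
  #constrained N U (threshold k free) ≡ #constrained N U (threshold k forbidden) + #constrained N U (threshold k required)
#constrained-free-split N k U i i≡k i∈U =
  trans (∑ₗ-cong (sublists (allSubsets N)) split) (∑ₗ-distrib-+ (sublists (allSubsets N)) _ _)
  where
  decide : ∀ X bs → Dec (ConstrainedPartition N U (threshold k X) bs)
  decide X bs = constrainedPartition? N U (threshold k X) bs
  count : Constraint → List (Subset N) → ℕ
  count X bs = χ? (decide X bs)
  relax : ∀ {bs} X → ConstrainedPartition N U (threshold k X) bs → ConstrainedPartition N U (threshold k free) bs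
  relax {bs} X = ConstrainedPartition-weaken U bs (threshold k X) (threshold k free)
    (λ j _ → Satisfies-threshold-change k X free (toℕ j) (λ _ _ → tt))
  settle : ∀ {bs} X → Satisfies X (HasSingleton N k bs) →
           ConstrainedPartition N U (threshold k free) bs → ConstrainedPartition N U (threshold k X) bs
  settle {bs} X sat = ConstrainedPartition-weaken U bs (threshold k free) (threshold k X)
    (λ j _ → Satisfies-threshold-change k free X (toℕ j)
      (λ j≡k _ → Satisfies-map X (subst (λ z → HasSingleton N z bs) (sym j≡k)) (subst (λ z → HasSingleton N z bs) j≡k) sat))
  forced : ∀ {bs} X → ConstrainedPartition N U (threshold k X) bs → Satisfies X (HasSingleton N k bs)
  forced {bs} X (_ , _ , _ , respects) = Satisfies-threshold-at k X i bs i≡k (respects i i∈U)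
  split : ∀ bs → count free bs ≡ count forbidden bs + count required bs
  split bs with hasSingleton? N k bs
  ... | yes singleton = begin
    count free bs                            ≡⟨ χ?-cong (settle required singleton) (relax required) (decide free bs) (decide required bs) ⟩
    count required bs                        ≡⟨ cong (_+ count required bs) (sym (χ?-no (λ p → forced forbidden p singleton) (decide forbidden bs))) ⟩
    count forbidden bs + count required bs   ∎
    where open ≡-Reasoning
  ... | no ¬singleton = begin
    count free bs                            ≡⟨ χ?-cong (settle forbidden ¬singleton) (relax forbidden) (decide free bs) (decide forbidden bs) ⟩
    count forbidden bs                       ≡⟨ sym (+-identityʳ _) ⟩
    count forbidden bs + 0                   ≡⟨ cong (count forbidden bs +_) (sym (χ?-no (λ p → ¬singleton (forced required p)) (decide required bs))) ⟩
    count forbidden bs + count required bs   ∎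
    where open ≡-Reasoning

full : (N : ℕ) → Subset N
full N = replicate N true

size-full : ∀ N → size (full N) ≡ N
size-full zero    = refl
size-full (suc N) = cong suc (size-full N)

removeAt-[]≔false : ∀ {N} (i : Fin (suc N)) (V : Vec Bool (suc N)) → removeAt (V [ i ]≔ false) i ≡ removeAt V i
removeAt-[]≔false         zero    (v ∷ V)      = refl
removeAt-[]≔false {suc N} (suc zero)    (v ∷ v′ ∷ V) = refl
removeAt-[]≔false {suc N} (suc (suc i)) (v ∷ v′ ∷ V) = cong (v ∷_) (removeAt-[]≔false (suc i) (v′ ∷ V))

removeAt-full : ∀ {N} (i : Fin (suc N)) → removeAt (full (suc N)) i ≡ full N
removeAt-full         zero    = refl
removeAt-full {suc N} (suc i) = cong (true ∷_) (removeAt-full i)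

module _ (N k : ℕ) (bs : List (Subset (suc N))) where

  partition⇒constrained : IsPartition (suc N) bs × LargestSingleton (suc N) k bs →
    ConstrainedPartition (suc N) (full (suc N)) (threshold k required) bs
  partition⇒constrained ((nonempty , disjoint , covers) , (singleton-k , ¬singleton-above)) =
    nonempty , disjoint , (λ i → (λ _ → covers i) , (λ _ → lookup-replicate i true)) , respects
    where
    respects : Respects (suc N) (full (suc N)) (threshold k required) bs
    respects i _ with threshold-view k required (toℕ i)
    ... | below _   eq = subst (λ ℓ → Satisfies ℓ _) (sym eq) tt
    ... | at    i≡k eq = subst (λ ℓ → Satisfies ℓ _) (sym eq) (subst (λ z → HasSingleton (suc N) z bs) (sym i≡k) singleton-k)
    ... | above k<i eq = subst (λ ℓ → Satisfies ℓ _) (sym eq) (¬singleton-above i k<i)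

  constrained⇒partition : k ≤ N → ConstrainedPartition (suc N) (full (suc N)) (threshold k required) bs →
    IsPartition (suc N) bs × LargestSingleton (suc N) k bs
  constrained⇒partition k≤N (nonempty , disjoint , covers , respects) =
    (nonempty , disjoint , (λ i → proj₁ (covers i) (lookup-replicate i true))) ,
    (Satisfies-threshold-at k required k′ bs (toℕ-fromℕ< (s≤s k≤N)) (respects k′ (lookup-replicate k′ true)) , ¬singleton-above)
    where
    k′ : Fin (suc N)
    k′ = fromℕ< (s≤s k≤N)
    ¬singleton-above : (i : Fin (suc N)) → k < toℕ i → ¬ HasSingleton (suc N) (toℕ i) bs
    ¬singleton-above i k<i with threshold-view k required (toℕ i) | respects i (lookup-replicate i true)
    ... | below i<k _  | _   = ⊥-elim (<-asym i<k k<i)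
    ... | at    i≡k _  | _   = ⊥-elim (<-irrefl (sym i≡k) k<i)
    ... | above _   eq | sat = subst (λ ℓ → Satisfies ℓ _) eq sat

A≡#constrained : ∀ N k → k ≤ N → A N k ≡ #constrained (suc N) (full (suc N)) (threshold k required)
A≡#constrained N k k≤N = trans (length-filter≡∑χ partition? (sublists (allSubsets (suc N))))
  (∑ₗ-cong (sublists (allSubsets (suc N))) (λ bs → χ?-cong (partition⇒constrained N k bs) (constrained⇒partition N k bs k≤N)
    (partition? bs) (constrainedPartition? (suc N) (full (suc N)) (threshold k required) bs)))
  where
  partition? : ∀ bs → Dec (IsPartition (suc N) bs × LargestSingleton (suc N) k bs)
  partition? bs = isPartition? (suc N) bs ×-dec largestSingleton? (suc N) k bs

#noSingletonsFrom : ℕ → ℕ → ℕ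
#noSingletonsFrom k N = #partitions N (full N) (threshold k forbidden)

module _ (N k : ℕ) (k≤N : k ≤ N) where

  private
    k′ : Fin (suc N)
    k′ = fromℕ< (s≤s k≤N)
    k′≡k : toℕ k′ ≡ k
    k′≡k = toℕ-fromℕ< (s≤s k≤N)
    k′∈full : lookup (full (suc N)) k′ ≡ true
    k′∈full = lookup-replicate k′ true

  #partitions-required : #partitions (suc N) (full (suc N)) (threshold k required) ≡ #noSingletonsFrom k N
  #partitions-required = begin
    #partitions (suc N) (full (suc N)) (threshold k required)
      ≡⟨ #partitions-remove-required (suc N) (full (suc N)) k′ (threshold k required) k′∈full
           (trans (cong (threshold k required) k′≡k) (threshold-at k required)) ⟩
    #partitions (suc N) (full (suc N) [ k′ ]≔ false) (threshold k required)
      ≡⟨ #partitions-removeAt N (full (suc N) [ k′ ]≔ false) k′ (threshold k required) (lookup∘update k′ (full (suc N)) false) ⟩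
    #partitions N (removeAt (full (suc N) [ k′ ]≔ false) k′) (threshold k required ∘ punchInℕ (toℕ k′))
      ≡⟨ cong₂ (λ V j → #partitions N V (threshold k required ∘ punchInℕ j))
               (trans (removeAt-[]≔false k′ (full (suc N))) (removeAt-full k′)) k′≡k ⟩
    #partitions N (full N) (threshold k required ∘ punchInℕ k)
      ≡⟨ #partitions-cong N (full N) _ _ (λ x _ → threshold-punchIn k x) ⟩
    #noSingletonsFrom k N
      ∎
    where open ≡-Reasoning

  #partitions-free-split : #partitions (suc N) (full (suc N)) (threshold k free)
    ≡ #partitions (suc N) (full (suc N)) (threshold k forbidden) + #partitions (suc N) (full (suc N)) (threshold k required)
  #partitions-free-split = begin
    #partitions (suc N) (full (suc N)) (threshold k free)
      ≡⟨ sym (#constrained≡#partitions (suc N) (full (suc N)) (threshold k free)) ⟩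
    #constrained (suc N) (full (suc N)) (threshold k free)
      ≡⟨ #constrained-free-split (suc N) k (full (suc N)) k′ k′≡k k′∈full ⟩
    #constrained (suc N) (full (suc N)) (threshold k forbidden) + #constrained (suc N) (full (suc N)) (threshold k required)
      ≡⟨ cong₂ _+_ (#constrained≡#partitions (suc N) (full (suc N)) (threshold k forbidden))
                   (#constrained≡#partitions (suc N) (full (suc N)) (threshold k required)) ⟩
    #partitions (suc N) (full (suc N)) (threshold k forbidden) + #partitions (suc N) (full (suc N)) (threshold k required)
      ∎
    where open ≡-Reasoning

  A≡#noSingletonsFrom : A N k ≡ #noSingletonsFrom k N
  A≡#noSingletonsFrom = trans (A≡#constrained N k k≤N)
    (trans (#constrained≡#partitions (suc N) (full (suc N)) (threshold k required)) #partitions-required)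

  #noSingletonsFrom-suc : #noSingletonsFrom (suc k) (suc N) ≡ #noSingletonsFrom k (suc N) + #noSingletonsFrom k N
  #noSingletonsFrom-suc = begin
    #noSingletonsFrom (suc k) (suc N)
      ≡⟨ sym (#partitions-cong (suc N) (full (suc N)) _ _ (λ x _ → threshold-free k x)) ⟩
    #partitions (suc N) (full (suc N)) (threshold k free)
      ≡⟨ #partitions-free-split ⟩
    #noSingletonsFrom k (suc N) + #partitions (suc N) (full (suc N)) (threshold k required)
      ≡⟨ cong (#noSingletonsFrom k (suc N) +_) #partitions-required ⟩
    #noSingletonsFrom k (suc N) + #noSingletonsFrom k N
      ∎
    where open ≡-Reasoning

#noSingletonsFrom-bell : ∀ k → #noSingletonsFrom k k ≡ bell k
#noSingletonsFrom-bell k = begin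
  #partitions k (full k) (threshold k forbidden)
    ≡⟨ #partitions-cong k (full k) _ _ (λ x x<k → threshold-below forbidden x<k) ⟩
  #partitions k (full k) (λ _ → free)
    ≡⟨ #partitions-free≡bell k (full k) ⟩
  bell (size (full k))
    ≡⟨ cong bell (size-full k) ⟩
  bell k
    ∎
  where open ≡-Reasoning

bellTable : ℕ → ℕ → ℕ
bellTable k j = #noSingletonsFrom k (k + j)

bellTable-suc : ∀ k j → bellTable (suc k) j ≡ bellTable k (suc j) + bellTable k j
bellTable-suc k j = trans (#noSingletonsFrom-suc (k + j) k (m≤m+n k j))
                          (cong (λ N → #noSingletonsFrom k N + bellTable k j) (sym (+-suc k j)))

bellTable-bell : ∀ k → bellTable k 0 ≡ bell k
bellTable-bell k = trans (cong (#noSingletonsFrom k) (+-identityʳ k)) (#noSingletonsFrom-bell k)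

A≡bellTable : ∀ j k → A (j + k) k ≡ bellTable k j
A≡bellTable j k = trans (A≡#noSingletonsFrom (j + k) k (m≤n+m k j)) (cong (#noSingletonsFrom k) (+-comm j k))

open import Data.Integer using (+_; _-_)

theorem4p7 : (n k p : ℕ) → Prime p →
    ((∀ m → m ≤ p ∸ 2 → p ∣ A (n + m + k) k)
      ⇔ (∀ m → 1 ≤ m → m ≤ p ∸ 1 → (+ p) ∣ℤ ((+ A (n + m + k) k) - (+ A (n + p * m + k) k))))
theorem4p7 n k zero          p-prime = ⊥-elim (¬prime[0] p-prime)
theorem4p7 n k (suc zero)    p-prime = ⊥-elim (¬prime[1] p-prime)
theorem4p7 n k (suc (suc q)) p-prime = mk⇔
  (λ vanish m 1≤m m≤p-1 → ≋⇒A-congruence m (to (λ i i≤q → subst (p ∣_) (A≡b i) (vanish i i≤q)) m 1≤m m≤p-1))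
  (λ congruent m m≤q → subst (p ∣_) (sym (A≡b m)) (from (λ i 1≤i i≤p-1 → A-congruence⇒≋ i (congruent i 1≤i i≤p-1)) m m≤q))
  where
  open ModuloPrime p-prime
  open BellTable bellTable bellTable-suc bellTable-bell
  b : ℕ → ℕ
  b m = bellTable k (n + m)
  A≡b : ∀ m → A (n + m + k) k ≡ b m
  A≡b m = A≡bellTable (n + m) k
  open Equivalence (vanishing⇔congruent b (λ m → g-shift-multiple p-prime k m n))
  ≋⇒A-congruence : ∀ m → b m ≋ b (p * m) → + p ∣ℤ + A (n + m + k) k - + A (n + p * m + k) k
  ≋⇒A-congruence m bm≋bpm = subst₂ (λ x y → + p ∣ℤ + x - + y) (sym (A≡b m)) (sym (A≡b (p * m))) (≋⇒∣ℤ bm≋bpm)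
  A-congruence⇒≋ : ∀ m → + p ∣ℤ + A (n + m + k) k - + A (n + p * m + k) k → b m ≋ b (p * m)
  A-congruence⇒≋ m p∣A-A = ∣ℤ⇒≋ (subst₂ (λ x y → + p ∣ℤ + x - + y) (A≡b m) (A≡b (p * m)) p∣A-A)
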